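{- A connected bipartite graph $G$ is $2$-$\gamma_{\rm MB}'$-critical if and only if either $G$ is isomorphic to $K_{2,m}$ for some $m\ge 3$, or $G$ is isomorphic to $B_{n,m}$ for some $n,m\ge 3$.
   Context: For $n,m\ge 3$, $B_{n,m}$ is the (unique up to isomorphism) bipartite graph with bipartition $V_1,V_2$, $|V_1|=n$, $|V_2|=m$, in which $V_1$ contains exactly two vertices of degree $m$, $V_2$ contains exactly two vertices of degree $n$, and all other vertices have degree $2$. The Maker-Breaker domination (MBD) game on a graph $G$ is played by Dominator and Staller, who alternately select previously unselected vertices of $G$. Dominator wins if the set of vertices he has selected becomes a dominating set of $G$; Staller wins if she has selected at least one vertex of every dominating set of $G$. In the S-game Staller moves first. $\gamma_{\rm MB}'(G)$ is the minimum number $k$ such that Dominator has a strategy in the S-game guaranteeing that he wins having made at most $k$ moves, whatever Staller does; $\gamma_{\rm MB}'(G)=\infty$ if Dominator has no winning strategy in the S-game. A graph $G$ is $k$-$\gamma_{\rm MB}'$-critical if $\gamma_{\rm MB}'(G)=k$ and $\gamma_{\rm MB}'(G)<\gamma_{\rm MB}'(G-e)$ for every $e\in E(G)$. -}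

module Defs where

open import Data.Nat using (ℕ; zero; suc; _∸_; _<ᵇ_; _≤_; _<_)
open import Data.Bool using (Bool; true; false; _∧_; _∨_; not; _xor_; if_then_else_)
open import Data.Bool.Properties using (∧-comm; ∨-comm)
open import Data.Fin using (Fin; toℕ)
open import Data.Fin.Subset using (Subset; _∈_; _∉_; ⁅_⁆; _∪_; ⊥)
open import Data.Product using (Σ; ∃; ∃-syntax; _×_; _,_)
open import Data.Sum using (_⊎_)
import Data.Empty
import Data.Nat
open import Relation.Nullary using (¬_; does)
open import Relation.Binary.PropositionalEquality using (_≡_; refl; _≢_; cong₂)
open import Function.Bundles using (_↔_; Inverse)
import Data.Fin as Fin

record Graph : Set where
  field
    n      : ℕ
    Adj    : Fin n → Fin n → Bool
    sym    : ∀ x y → Adj x y ≡ Adj y x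
    irrefl : ∀ x → Adj x x ≡ false
open Graph public

-- edges (ordered pair representing the unordered edge {u,v})
Edge : Graph → Set
Edge G = Σ (Fin (n G)) λ u → Σ (Fin (n G)) λ v → Adj G u v ≡ true

private
  eqb : ∀ {k} → Fin k → Fin k → Bool
  eqb x y = does (x Fin.≟ y)

  xor-comm : ∀ a b → a xor b ≡ b xor a
  xor-comm false false = refl
  xor-comm false true  = refl
  xor-comm true  false = refl
  xor-comm true  true  = refl

  xor-self : ∀ a → a xor a ≡ false
  xor-self false = refl
  xor-self true  = refl

  ∧-false : ∀ a → a ∧ false ≡ false
  ∧-false false = refl
  ∧-false true  = refl

removeEdge : (G : Graph) → Edge G → Graph
removeEdge G (u , v , _) = record
  { n      = n G
  ; Adj    = A
  ; sym    = s
  ; irrefl = λ x → ir x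
  }
  where
  hit : Fin (n G) → Fin (n G) → Bool
  hit x y = (eqb x u ∧ eqb y v) ∨ (eqb x v ∧ eqb y u)
  A : Fin (n G) → Fin (n G) → Bool
  A x y = Adj G x y ∧ not (hit x y)
  hit-sym : ∀ x y → hit x y ≡ hit y x
  hit-sym x y rewrite ∧-comm (eqb x u) (eqb y v) | ∧-comm (eqb x v) (eqb y u)
    = ∨-comm (eqb y v ∧ eqb x u) (eqb y u ∧ eqb x v)
  s : ∀ x y → A x y ≡ A y x
  s x y = cong₂ (λ a b → a ∧ not b) (sym G x y) (hit-sym x y)
  ir : ∀ x → A x x ≡ false
  ir x rewrite irrefl G x = refl

data Walk (G : Graph) : Fin (n G) → Fin (n G) → Set where
  here : ∀ {x} → Walk G x x
  step : ∀ {x y z} → Adj G x y ≡ true → Walk G y z → Walk G x z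

Connected : Graph → Set
Connected G = ∀ x y → Walk G x y

Bipartite : Graph → Set
Bipartite G = Σ (Fin (n G) → Bool) λ c → ∀ x y → Adj G x y ≡ true → c x ≢ c y

_≅_ : Graph → Graph → Set
G ≅ H = Σ (Fin (n G) ↔ Fin (n H)) λ f →
          ∀ x y → Adj G x y ≡ Adj H (Inverse.to f x) (Inverse.to f y)

Dominating : (G : Graph) → Subset (n G) → Set
Dominating G D = ∀ v → v ∈ D ⊎ ∃[ u ] (u ∈ D × Adj G u v ≡ true)

Free : (G : Graph) → Subset (n G) → Subset (n G) → Fin (n G) → Set
Free G D S v = v ∉ D × v ∉ S

mutual
  -- Staller to move; D = Dominator's vertices, S = Staller's vertices.
  -- Dominator can force a win making at most k further moves.
  StallerTurn : (G : Graph) → ℕ → Subset (n G) → Subset (n G) → Set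
  StallerTurn G k D S =
    Dominating G D ⊎
    ((∃[ v ] Free G D S v) ×
     (∀ v → Free G D S v → DominatorTurn G k D (S ∪ ⁅ v ⁆)))

  DominatorTurn : (G : Graph) → ℕ → Subset (n G) → Subset (n G) → Set
  DominatorTurn G k D S = Dominating G D ⊎ DomStep G k D S

  DomStep : (G : Graph) → ℕ → Subset (n G) → Subset (n G) → Set
  DomStep G zero    D S = Data.Empty.⊥
  DomStep G (suc k) D S = ∃[ v ] (Free G D S v × StallerTurn G k (D ∪ ⁅ v ⁆) S)

-- γ'_MB(G) ≤ k : in the S-game Dominator wins with at most k moves
SGameWinWithin : Graph → ℕ → Set
SGameWinWithin G k = StallerTurn G k ⊥ ⊥

γMB'≡ : Graph → ℕ → Set
γMB'≡ G k = SGameWinWithin G k × (∀ j → j < k → ¬ SGameWinWithin G j)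

-- γ'_MB(H) > k  (including γ'_MB(H) = ∞)
γMB'> : Graph → ℕ → Set
γMB'> H k = ∀ j → j ≤ k → ¬ SGameWinWithin H j

Critical : Graph → ℕ → Set
Critical G k = γMB'≡ G k × (∀ (e : Edge G) → γMB'> (removeEdge G e) k)

K2 : ℕ → Graph
K2 m = record
  { n = 2 Data.Nat.+ m
  ; Adj = λ x y → side x xor side y
  ; sym = λ x y → xor-comm (side x) (side y)
  ; irrefl = λ x → xor-self (side x)
  }
  where
  side : Fin (2 Data.Nat.+ m) → Bool
  side x = toℕ x <ᵇ 2

-- B_{n,m}: V1 = {0..n-1}, V2 = {n..n+m-1}; the first two vertices of each
-- side ("hubs") are adjacent to every vertex of the other side; two
-- non-hub vertices are never adjacent.
B : ℕ → ℕ → Graph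
B p q = record
  { n = p Data.Nat.+ q
  ; Adj = A
  ; sym = λ x y → cong₂ _∧_ (xor-comm (side x) (side y)) (∨-comm (hub x) (hub y))
  ; irrefl = λ x → ir x
  }
  where
  side : Fin (p Data.Nat.+ q) → Bool
  side x = toℕ x <ᵇ p
  hub : Fin (p Data.Nat.+ q) → Bool
  hub x = (if side x then toℕ x else toℕ x ∸ p) <ᵇ 2
  A : Fin (p Data.Nat.+ q) → Fin (p Data.Nat.+ q) → Bool
  A x y = (side x xor side y) ∧ (hub x ∨ hub y)
  ir : ∀ x → A x x ≡ false
  ir x rewrite xor-self (side x) = refl

{-# OPTIONS --safe #-}
-- Dominator wins the S-game with at most two moves iff for every opening v of Staller he has a
-- reply u such that, whatever vertex w Staller takes next, some x ≠ w makes {u, x} dominating.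
-- If both colour classes of a bipartite graph have at least three vertices, such a reply u and
-- its two possible completions x are universal (adjacent to the whole other class); this gives
-- two universal vertices in each class, and conversely two universal vertices per class let
-- Dominator win. Criticality then forces every edge to meet one of these four hubs, so G is
-- B_{n,m}. If a colour class has at most two vertices, a short case analysis leaves only K_{2,m}:
-- the other candidates have an isolated vertex, a vertex cover of size one or a non-edge between
-- the two-vertex class and the rest (Staller wins), are K₂ (Dominator wins with one move), or
-- have four vertices, where connectivity yields a perfect matching surviving the deletion of an
-- edge. Conversely, deleting an edge of K_{2,m} or B_{n,m} at a hub gives Staller a winning strategy.
module Submission where

open import Defs hiding (sym)
open import Data.Nat using (ℕ; zero; suc; _+_; _∸_; _≤_; _<ᵇ_; z≤n; s≤s)
open import Data.Nat.Properties using (≤-pred; ≤-refl; m+n∸m≡n)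
open import Data.Bool using (Bool; true; false; not; _∧_; _∨_; _xor_; if_then_else_) renaming (_≟_ to _≟ᵇ_)
open import Data.Bool.Properties
  using (¬-not; not-¬; not-injective; not-involutive; ∧-conicalˡ; ∧-conicalʳ; ∨-zeroʳ; xor-same)
open import Data.Fin using (Fin; zero; suc; toℕ; join; _↑ˡ_; _↑ʳ_; punchOut; _≟_)
open import Data.Fin.Properties using (any?; toℕ-↑ˡ; toℕ-↑ʳ; punchOut-injective; +↔⊎; join-splitAt)
open import Data.Fin.Subset using (Subset; _∈_; _∉_; ⁅_⁆; _∪_) renaming (⊥ to ∅)
open import Data.Fin.Subset.Properties using (∉⊥; x∈⁅x⁆; x∈⁅y⁆⇒x≡y; x∈p∪q⁻; x∈p∪q⁺)
open import Data.Product using (Σ; ∃-syntax; _×_; _,_; proj₁; proj₂)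
open import Data.Sum using (_⊎_; inj₁; inj₂; [_,_]′; map; map₁; swap)
open import Data.Sum.Properties using (inj₁-injective; inj₂-injective)
open import Data.Sum.Algebra using (⊎-comm)
open import Data.Sum.Function.Propositional using (_⊎-↔_)
open import Data.Empty using (⊥; ⊥-elim)
open import Function using (_∘_; id)
open import Function.Bundles using (_↔_; _⇔_; Inverse; Injection; mk↔ₛ′; mk⇔)
open import Function.Construct.Composition using (_↔-∘_)
open import Function.Construct.Symmetry using (↔-sym)
open import Function.Construct.Identity using (↔-id)
open import Function.Properties.Inverse using (↔⇒↣)
open import Relation.Nullary using (¬_; yes; no; Dec; does)
open import Relation.Nullary.Decidable using (_×-dec_; _⊎-dec_; ¬?; dec-true; dec-false)
open import Relation.Unary using (Decidable)
open import Relation.Binary.PropositionalEquality using (_≡_; refl; _≢_; sym; trans; cong; cong₂; subst)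

-- Graphs and domination

V : Graph → Set
V G = Fin (n G)

Adjacent : (G : Graph) → V G → V G → Set
Adjacent G x y = Adj G x y ≡ true

Dominates : (G : Graph) → V G → V G → Set
Dominates G u z = z ≡ u ⊎ Adjacent G u z

DominatingVertex : (G : Graph) → V G → Set
DominatingVertex G u = ∀ z → Dominates G u z

DominatingPair : (G : Graph) → V G → V G → Set
DominatingPair G u x = ∀ z → Dominates G u z ⊎ Dominates G x z

DominatedBy : (G : Graph) → Subset (n G) → V G → Set
DominatedBy G D z = z ∈ D ⊎ ∃[ u ] (u ∈ D × Adjacent G u z)

adjacent-sym : ∀ G {x y} → Adjacent G x y → Adjacent G y x
adjacent-sym G {x} {y} xy = trans (Graph.sym G y x) xy

adjacent⇒≢ : ∀ G {x y} → Adjacent G x y → x ≢ y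
adjacent⇒≢ G {x} xy refl with trans (sym xy) (irrefl G x)
... | ()

walk-closed : ∀ G (P : V G → Set) → (∀ {x y} → P x → Adjacent G x y → P y) →
              ∀ {x y} → Walk G x y → P x → P y
walk-closed G P closed here         Px = Px
walk-closed G P closed (step xz zy) Px = walk-closed G P closed zy (closed Px xz)

module _ {m : ℕ} where

  ∈-∪⁅⁆ : ∀ {D : Subset m} {u z} → z ∈ D ∪ ⁅ u ⁆ → z ∈ D ⊎ z ≡ u
  ∈-∪⁅⁆ {D} {u} z∈ with x∈p∪q⁻ D ⁅ u ⁆ z∈
  ... | inj₁ z∈D = inj₁ z∈D
  ... | inj₂ z∈u = inj₂ (x∈⁅y⁆⇒x≡y u z∈u)

  ∈-∅∪⁅⁆ : ∀ {u z : Fin m} → z ∈ (∅ ∪ ⁅ u ⁆) → z ≡ u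
  ∈-∅∪⁅⁆ = [ ⊥-elim ∘ ∉⊥ , id ]′ ∘ ∈-∪⁅⁆

  ∉-∅∪⁅⁆ : ∀ {u z : Fin m} → z ≢ u → z ∉ (∅ ∪ ⁅ u ⁆)
  ∉-∅∪⁅⁆ z≢u = z≢u ∘ ∈-∅∪⁅⁆

  ∉-∅∪⁅,⁆ : ∀ {u x z : Fin m} → z ≢ u → z ≢ x → z ∉ (∅ ∪ ⁅ u ⁆) ∪ ⁅ x ⁆
  ∉-∅∪⁅,⁆ z≢u z≢x = [ z≢u ∘ ∈-∅∪⁅⁆ , z≢x ]′ ∘ ∈-∪⁅⁆

  ∉∪⁅⁆⇒≢ : ∀ {D : Subset m} {u z} → z ∉ D ∪ ⁅ u ⁆ → z ≢ u
  ∉∪⁅⁆⇒≢ {u = u} z∉ refl = z∉ (x∈p∪q⁺ (inj₂ (x∈⁅x⁆ u)))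

  ∉∪⁅⁆⇒∉ : ∀ {D : Subset m} {u z} → z ∉ D ∪ ⁅ u ⁆ → z ∉ D
  ∉∪⁅⁆⇒∉ z∉ z∈D = z∉ (x∈p∪q⁺ (inj₁ z∈D))

-- The S-game with at most two Dominator moves

mutual
  stallerTurn-mono : ∀ {G j k D S} → j ≤ k → StallerTurn G j D S → StallerTurn G k D S
  stallerTurn-mono j≤k (inj₁ dom) = inj₁ dom
  stallerTurn-mono j≤k (inj₂ (free , next)) = inj₂ (free , λ v p → dominatorTurn-mono j≤k (next v p))

  dominatorTurn-mono : ∀ {G j k D S} → j ≤ k → DominatorTurn G j D S → DominatorTurn G k D S
  dominatorTurn-mono j≤k (inj₁ dom) = inj₁ dom
  dominatorTurn-mono {j = suc _} (s≤s j≤k) (inj₂ (v , free , next)) =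
    inj₂ (v , free , stallerTurn-mono j≤k next)

¬win₀⇒vertex : ∀ G → ¬ SGameWinWithin G 0 → V G
¬win₀⇒vertex G ¬win₀ = [ (λ empty → ⊥-elim (¬win₀ (inj₁ (⊥-elim ∘ empty)))) , id ]′ (empty⊎inhabited (n G))
  where
  empty⊎inhabited : ∀ m → (Fin m → ⊥) ⊎ Fin m
  empty⊎inhabited zero    = inj₁ λ ()
  empty⊎inhabited (suc m) = inj₂ zero

critical₂-intro : ∀ {G} → SGameWinWithin G 2 → ¬ SGameWinWithin G 1 →
                  (∀ e → ¬ SGameWinWithin (removeEdge G e) 2) → Critical G 2
critical₂-intro win ¬win₁ ¬win-e =
  (win , λ j j<2 → ¬win₁ ∘ stallerTurn-mono (≤-pred j<2)) , λ e j j≤2 → ¬win-e e ∘ stallerTurn-mono j≤2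

module _ (G : Graph) where

  dominatedBy-∪⁅⁆⁻ : ∀ {D : Subset (n G)} {u z} → DominatedBy G (D ∪ ⁅ u ⁆) z →
                     DominatedBy G D z ⊎ Dominates G u z
  dominatedBy-∪⁅⁆⁻ {D} {u} (inj₁ z∈) with ∈-∪⁅⁆ {D = D} {u} z∈
  ... | inj₁ z∈D = inj₁ (inj₁ z∈D)
  ... | inj₂ z≡u = inj₂ (inj₁ z≡u)
  dominatedBy-∪⁅⁆⁻ {D} {u} (inj₂ (w , w∈ , wz)) with ∈-∪⁅⁆ {D = D} {u} w∈
  ... | inj₁ w∈D = inj₁ (inj₂ (w , w∈D , wz))
  ... | inj₂ refl = inj₂ (inj₂ wz)

  dominatedBy-∪⁅⁆⁺ : ∀ {D : Subset (n G)} {u z} → DominatedBy G D z ⊎ Dominates G u z →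
                     DominatedBy G (D ∪ ⁅ u ⁆) z
  dominatedBy-∪⁅⁆⁺ (inj₁ (inj₁ z∈D)) = inj₁ (x∈p∪q⁺ (inj₁ z∈D))
  dominatedBy-∪⁅⁆⁺ (inj₁ (inj₂ (w , w∈D , wz))) = inj₂ (w , x∈p∪q⁺ (inj₁ w∈D) , wz)
  dominatedBy-∪⁅⁆⁺ {u = u} (inj₂ (inj₁ refl)) = inj₁ (x∈p∪q⁺ (inj₂ (x∈⁅x⁆ u)))
  dominatedBy-∪⁅⁆⁺ {u = u} (inj₂ (inj₂ uz)) = inj₂ (u , x∈p∪q⁺ (inj₂ (x∈⁅x⁆ u)) , uz)

  ¬dominatedBy-∅ : ∀ {z} → ¬ DominatedBy G ∅ z
  ¬dominatedBy-∅ (inj₁ z∈∅) = ∉⊥ z∈∅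
  ¬dominatedBy-∅ (inj₂ (_ , w∈∅ , _)) = ∉⊥ w∈∅

  dominating-∅∪⁅⁆⁻ : ∀ {u} → Dominating G (∅ ∪ ⁅ u ⁆) → DominatingVertex G u
  dominating-∅∪⁅⁆⁻ dom z = [ ⊥-elim ∘ ¬dominatedBy-∅ , id ]′ (dominatedBy-∪⁅⁆⁻ (dom z))

  dominating-∅∪⁅⁆⁺ : ∀ {u} → DominatingVertex G u → Dominating G (∅ ∪ ⁅ u ⁆)
  dominating-∅∪⁅⁆⁺ dom z = dominatedBy-∪⁅⁆⁺ (inj₂ (dom z))

  dominating-∅∪⁅,⁆⁻ : ∀ {u x} → Dominating G ((∅ ∪ ⁅ u ⁆) ∪ ⁅ x ⁆) → DominatingPair G u x
  dominating-∅∪⁅,⁆⁻ dom z with dominatedBy-∪⁅⁆⁻ (dom z)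
  ... | inj₁ byU = inj₁ ([ ⊥-elim ∘ ¬dominatedBy-∅ , id ]′ (dominatedBy-∪⁅⁆⁻ byU))
  ... | inj₂ byX = inj₂ byX

  dominating-∅∪⁅,⁆⁺ : ∀ {u x} → DominatingPair G u x → Dominating G ((∅ ∪ ⁅ u ⁆) ∪ ⁅ x ⁆)
  dominating-∅∪⁅,⁆⁺ dom z = dominatedBy-∪⁅⁆⁺ ([ inj₁ ∘ dominatedBy-∪⁅⁆⁺ ∘ inj₂ , inj₂ ]′ (dom z))


  stallerTurn₀⇒dominating : ∀ {D S} → StallerTurn G 0 D S → Dominating G D
  stallerTurn₀⇒dominating (inj₁ dom) = dom
  stallerTurn₀⇒dominating (inj₂ ((v , free) , next)) with next v free
  ... | inj₁ dom = dom

  win₁⇒dominatingVertex : SGameWinWithin G 1 → ∀ v → ∃[ u ] (u ≢ v × DominatingVertex G u)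
  win₁⇒dominatingVertex (inj₁ dom) v = ⊥-elim (¬dominatedBy-∅ (dom v))
  win₁⇒dominatingVertex (inj₂ (_ , next)) v with next v (∉⊥ , ∉⊥)
  ... | inj₁ dom = ⊥-elim (¬dominatedBy-∅ (dom v))
  ... | inj₂ (u , (_ , u∉S) , st) = u , ∉∪⁅⁆⇒≢ u∉S , dominating-∅∪⁅⁆⁻ (stallerTurn₀⇒dominating st)

  noDominatingVertex⇒¬win₁ : V G → (∀ u → ¬ DominatingVertex G u) → ¬ SGameWinWithin G 1
  noDominatingVertex⇒¬win₁ v ¬dom win with win₁⇒dominatingVertex win v
  ... | u , _ , dom = ¬dom u dom

  win₁-intro : V G → (∀ v → ∃[ u ] (u ≢ v × DominatingVertex G u)) → SGameWinWithin G 1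
  win₁-intro v₀ answer = inj₂ ((v₀ , ∉⊥ , ∉⊥) , λ v _ → reply v (answer v))
    where
    reply : ∀ v → ∃[ u ] (u ≢ v × DominatingVertex G u) → DominatorTurn G 1 ∅ (∅ ∪ ⁅ v ⁆)
    reply v (u , u≢v , dom) = inj₂ (u , (∉⊥ , ∉-∅∪⁅⁆ u≢v) , inj₁ (dominating-∅∪⁅⁆⁺ dom))

  -- Staller opened with v and Dominator answered u. If no vertex is left for Staller, Dominator
  -- has lost unless u dominates alone.
  WinningReply : V G → V G → Set
  WinningReply v u =
    DominatingVertex G u ⊎
    (∃[ w ] (w ≢ u × w ≢ v)) ×
    (∀ w → w ≢ u → w ≢ v →
       DominatingVertex G u ⊎ ∃[ x ] (x ≢ u × x ≢ v × x ≢ w × DominatingPair G u x))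

  win₂⇒winningReply : SGameWinWithin G 2 → ∀ v → ∃[ u ] (u ≢ v × WinningReply v u)
  win₂⇒winningReply (inj₁ dom) v = ⊥-elim (¬dominatedBy-∅ (dom v))
  win₂⇒winningReply (inj₂ (_ , next)) v with next v (∉⊥ , ∉⊥)
  ... | inj₁ dom = ⊥-elim (¬dominatedBy-∅ (dom v))
  ... | inj₂ (u , (_ , u∉S) , inj₁ dom) = u , ∉∪⁅⁆⇒≢ u∉S , inj₁ (dominating-∅∪⁅⁆⁻ dom)
  ... | inj₂ (u , (_ , u∉S) , inj₂ ((w₀ , w₀∉D , w₀∉S) , next₂)) =
    u , ∉∪⁅⁆⇒≢ u∉S , inj₂ ((w₀ , ∉∪⁅⁆⇒≢ w₀∉D , ∉∪⁅⁆⇒≢ w₀∉S) , second)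
    where
    second : ∀ w → w ≢ u → w ≢ v →
             DominatingVertex G u ⊎ ∃[ x ] (x ≢ u × x ≢ v × x ≢ w × DominatingPair G u x)
    second w w≢u w≢v with next₂ w (∉-∅∪⁅⁆ w≢u , ∉-∅∪⁅⁆ w≢v)
    ... | inj₁ dom = inj₁ (dominating-∅∪⁅⁆⁻ dom)
    ... | inj₂ (x , (x∉D , x∉S) , st) =
      inj₂ (x , ∉∪⁅⁆⇒≢ x∉D , ∉∪⁅⁆⇒≢ {D = ∅} (∉∪⁅⁆⇒∉ x∉S) , ∉∪⁅⁆⇒≢ x∉S ,
            dominating-∅∪⁅,⁆⁻ (stallerTurn₀⇒dominating st))

  winningReply⇒pair : ∀ {v u w} → WinningReply v u → ¬ DominatingVertex G u → w ≢ u → w ≢ v →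
                      ∃[ x ] (x ≢ u × x ≢ v × x ≢ w × DominatingPair G u x)
  winningReply⇒pair (inj₁ dom) ¬dom _ _ = ⊥-elim (¬dom dom)
  winningReply⇒pair (inj₂ (_ , second)) ¬dom w≢u w≢v with second _ w≢u w≢v
  ... | inj₁ dom = ⊥-elim (¬dom dom)
  ... | inj₂ pair = pair

  winningReply⇒somePair : ∀ {v u} → WinningReply v u → ¬ DominatingVertex G u →
                          ∃[ x ] (x ≢ u × x ≢ v × DominatingPair G u x)
  winningReply⇒somePair reply@(inj₂ ((w , w≢u , w≢v) , _)) ¬dom
    with winningReply⇒pair reply ¬dom w≢u w≢v
  ... | x , x≢u , x≢v , _ , dom = x , x≢u , x≢v , dom
  winningReply⇒somePair (inj₁ dom) ¬dom = ⊥-elim (¬dom dom)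

  record Fork (v : V G) : Set where
    field
      centre x₁ x₂ : V G
      centre≢v     : centre ≢ v
      x₁≢x₂        : x₁ ≢ x₂
      x₁≢centre    : x₁ ≢ centre
      x₂≢centre    : x₂ ≢ centre
      x₁≢v         : x₁ ≢ v
      x₂≢v         : x₂ ≢ v
      dominating₁  : DominatingPair G centre x₁
      dominating₂  : DominatingPair G centre x₂

  win₂-intro : V G → (∀ v → Fork v) → SGameWinWithin G 2
  win₂-intro v₀ fork = inj₂ ((v₀ , ∉⊥ , ∉⊥) , λ v _ → reply v (fork v))
    where
    reply : ∀ v → Fork v → DominatorTurn G 2 ∅ (∅ ∪ ⁅ v ⁆)
    reply v f = inj₂ (centre , (∉⊥ , ∉-∅∪⁅⁆ centre≢v) ,
                      inj₂ ((x₁ , ∉-∅∪⁅⁆ x₁≢centre , ∉-∅∪⁅⁆ x₁≢v) , complete))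
      where
      open Fork f
      complete : ∀ w → Free G (∅ ∪ ⁅ centre ⁆) (∅ ∪ ⁅ v ⁆) w →
                 DominatorTurn G 1 (∅ ∪ ⁅ centre ⁆) ((∅ ∪ ⁅ v ⁆) ∪ ⁅ w ⁆)
      complete w _ with x₁ ≟ w
      ... | yes refl = inj₂ (x₂ , (∉-∅∪⁅⁆ x₂≢centre , ∉-∅∪⁅,⁆ x₂≢v (x₁≢x₂ ∘ sym)) ,
                             inj₁ (dominating-∅∪⁅,⁆⁺ dominating₂))
      ... | no x₁≢w = inj₂ (x₁ , (∉-∅∪⁅⁆ x₁≢centre , ∉-∅∪⁅,⁆ x₁≢v x₁≢w) ,
                             inj₁ (dominating-∅∪⁅,⁆⁺ dominating₁))

-- Bipartite graphs and universal vertices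

true≢false : ∀ {a b} → a ≡ true → b ≡ false → a ≢ b
true≢false refl refl ()

decided : ∀ {A : Set} (a? : Dec A) → does a? ≡ true → A
decided (yes a) _ = a

≢-same⇒≡ : ∀ {a b c : Bool} → a ≢ c → b ≢ c → a ≡ b
≢-same⇒≡ a≢c b≢c = trans (¬-not a≢c) (sym (¬-not b≢c))

by-colour : ∀ {ℓ} (P : Bool → Set ℓ) {b} → P b → P (not b) → ∀ σ → P σ
by-colour P {false} p q false = p
by-colour P {false} p q true  = q
by-colour P {true}  p q false = q
by-colour P {true}  p q true  = p

record Three {N} (P : Fin N → Set) : Set where
  constructor three
  field
    x₁ x₂ x₃ : Fin N
    x₁≢x₂ : x₁ ≢ x₂
    x₁≢x₃ : x₁ ≢ x₃
    x₂≢x₃ : x₂ ≢ x₃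
    P₁ : P x₁
    P₂ : P x₂
    P₃ : P x₃

data AtMostTwo {N} (P : Fin N → Set) : Set where
  none : (∀ x → ¬ P x) → AtMostTwo P
  one  : ∀ a → P a → (∀ x → P x → x ≡ a) → AtMostTwo P
  two  : ∀ a b → a ≢ b → P a → P b → (∀ x → P x → x ≡ a ⊎ x ≡ b) → AtMostTwo P

module _ {N} {P : Fin N → Set} where

  Three-map : ∀ {Q : Fin N → Set} → (∀ {x} → P x → Q x) → Three P → Three Q
  Three-map f (three x₁ x₂ x₃ x₁≢x₂ x₁≢x₃ x₂≢x₃ P₁ P₂ P₃) =
    three x₁ x₂ x₃ x₁≢x₂ x₁≢x₃ x₂≢x₃ (f P₁) (f P₂) (f P₃)

  avoidTwo : Three P → ∀ a b → ∃[ z ] (z ≢ a × z ≢ b × P z)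
  avoidTwo (three x₁ x₂ x₃ x₁≢x₂ x₁≢x₃ x₂≢x₃ P₁ P₂ P₃) a b with x₁ ≟ a | x₁ ≟ b
  ... | no x₁≢a | no x₁≢b = x₁ , x₁≢a , x₁≢b , P₁
  ... | yes refl | _ with x₂ ≟ b
  ...   | no x₂≢b  = x₂ , x₁≢x₂ ∘ sym , x₂≢b , P₂
  ...   | yes refl = x₃ , x₁≢x₃ ∘ sym , x₂≢x₃ ∘ sym , P₃
  avoidTwo (three x₁ x₂ x₃ x₁≢x₂ x₁≢x₃ x₂≢x₃ P₁ P₂ P₃) a b | no _ | yes refl with x₂ ≟ a
  ...   | no x₂≢a  = x₂ , x₂≢a , x₁≢x₂ ∘ sym , P₂
  ...   | yes refl = x₃ , x₂≢x₃ ∘ sym , x₁≢x₃ ∘ sym , P₃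

  census : Decidable P → AtMostTwo P ⊎ Three P
  census P? with any? P?
  ... | no ∄a = inj₁ (none λ x Px → ∄a (x , Px))
  ... | yes (a , Pa) with any? (λ x → P? x ×-dec ¬? (x ≟ a))
  ...   | no ∄b = inj₁ (one a Pa λ x Px → onlyA x Px)
    where
    onlyA : ∀ x → P x → x ≡ a
    onlyA x Px with x ≟ a
    ... | yes x≡a = x≡a
    ... | no x≢a  = ⊥-elim (∄b (x , Px , x≢a))
  ...   | yes (b , Pb , b≢a) with any? (λ x → P? x ×-dec ¬? (x ≟ a) ×-dec ¬? (x ≟ b))
  ...     | yes (c , Pc , c≢a , c≢b) = inj₂ (three a b c (b≢a ∘ sym) (c≢a ∘ sym) (c≢b ∘ sym) Pa Pb Pc)
  ...     | no ∄c = inj₁ (two a b (b≢a ∘ sym) Pa Pb onlyAB)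
    where
    onlyAB : ∀ x → P x → x ≡ a ⊎ x ≡ b
    onlyAB x Px with x ≟ a | x ≟ b
    ... | yes x≡a | _       = inj₁ x≡a
    ... | no _    | yes x≡b = inj₂ x≡b
    ... | no x≢a  | no x≢b  = ⊥-elim (∄c (x , Px , x≢a , x≢b))

record Bipartition (G : Graph) : Set where
  constructor bipartition
  field
    colour : V G → Bool
    proper : ∀ x y → Adjacent G x y → colour x ≢ colour y

module _ {G : Graph} (B : Bipartition G) where
  open Bipartition B

  Universal : V G → Set
  Universal x = ∀ y → colour y ≢ colour x → Adjacent G x y

  record UniversalPair (σ : Bool) : Set where
    constructor universalPair
    field
      first second     : V G
      first≢second     : first ≢ second
      colour-first     : colour first ≡ σ
      colour-second    : colour second ≡ σ
      universal-first  : Universal first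
      universal-second : Universal second

  swapColours : Bipartition G
  swapColours = bipartition (not ∘ colour) λ x y xy → proper x y xy ∘ not-injective

  sameColour⇒¬adjacent : ∀ {x y} → colour x ≡ colour y → Adj G x y ≡ false
  sameColour⇒¬adjacent {x} {y} sx≡sy = ¬-not (λ xy → proper x y xy sx≡sy)

  adjacent⇒opposite : ∀ {x y} → Adjacent G x y → colour y ≡ not (colour x)
  adjacent⇒opposite {x} {y} xy = ¬-not (proper x y xy ∘ sym)

  neighbour-colour : ∀ {x y σ} → colour x ≡ σ → Adjacent G x y → colour y ≡ not σ
  neighbour-colour refl = adjacent⇒opposite

  apart : ∀ {x y} → colour x ≡ true → colour y ≡ false → x ≢ y
  apart sx sy = true≢false sx sy ∘ cong colour

  twin⇒¬dominates : ∀ {u z} → z ≢ u → colour z ≡ colour u → ¬ Dominates G u z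
  twin⇒¬dominates z≢u sz≡su (inj₁ z≡u) = z≢u z≡u
  twin⇒¬dominates z≢u sz≡su (inj₂ uz)  = proper _ _ uz (sym sz≡su)

  twin⇒¬dominatingVertex : ∀ {u z} → z ≢ u → colour z ≡ colour u → ¬ DominatingVertex G u
  twin⇒¬dominatingVertex {z = z} z≢u sz≡su dom = twin⇒¬dominates z≢u sz≡su (dom z)

  universal⇒dominatingPair : ∀ {p q} → Universal p → Universal q → colour p ≢ colour q →
                             DominatingPair G p q
  universal⇒dominatingPair {p} {q} universal-p universal-q sp≢sq z with colour z ≟ᵇ colour p
  ... | yes sz≡sp = inj₂ (inj₂ (universal-q z (sp≢sq ∘ trans (sym sz≡sp))))
  ... | no sz≢sp  = inj₁ (inj₂ (universal-p z sz≢sp))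

  member-avoiding : ∀ {σ} → UniversalPair σ → ∀ v → ∃[ u ] (u ≢ v × colour u ≡ σ × Universal u)
  member-avoiding (universalPair a b a≢b sa sb ua ub) v with a ≟ v
  ... | yes refl = b , a≢b ∘ sym , sb , ub
  ... | no a≢v   = a , a≢v , sa , ua

  universalPairs⇒win₂ : (∀ σ → UniversalPair σ) → SGameWinWithin G 2
  universalPairs⇒win₂ pair = win₂-intro G (UniversalPair.first (pair true)) fork
    where
    fork : ∀ v → Fork G v
    fork v with member-avoiding (pair (colour v)) v | pair (not (colour v))
    ... | u , u≢v , su , uu | universalPair c d c≢d sc sd uc ud = record
      { centre = u ; x₁ = c ; x₂ = d ; centre≢v = u≢v ; x₁≢x₂ = c≢d
      ; x₁≢centre = distinct sc su ; x₂≢centre = distinct sd su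
      ; x₁≢v = distinct sc refl ; x₂≢v = distinct sd refl
      ; dominating₁ = universal⇒dominatingPair uu uc (differ sc su)
      ; dominating₂ = universal⇒dominatingPair uu ud (differ sd su)
      }
      where
      differ : ∀ {x y} → colour x ≡ not (colour v) → colour y ≡ colour v → colour y ≢ colour x
      differ sx sy sy≡sx = not-¬ refl (trans (sym sy) (trans sy≡sx sx))
      distinct : ∀ {x y} → colour x ≡ not (colour v) → colour y ≡ colour v → x ≢ y
      distinct sx sy x≡y = differ sx sy (cong colour (sym x≡y))

module LargeClasses {G : Graph} (B : Bipartition G)
                    (large : ∀ σ → Three (λ x → Bipartition.colour B x ≡ σ)) where
  open Bipartition B

  ¬dominatingVertex : ∀ u → ¬ DominatingVertex G u
  ¬dominatingVertex u with avoidTwo (large (colour u)) u u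
  ... | z , z≢u , _ , sz = twin⇒¬dominatingVertex B z≢u sz

  dominatingPair⇒opposite : ∀ {u x} → DominatingPair G u x → colour x ≢ colour u
  dominatingPair⇒opposite {u} {x} dom sx≡su with avoidTwo (large (colour u)) u x
  ... | z , z≢u , z≢x , sz with dom z
  ... | inj₁ (inj₁ z≡u) = z≢u z≡u
  ... | inj₁ (inj₂ uz)  = proper u z uz (sym sz)
  ... | inj₂ (inj₁ z≡x) = z≢x z≡x
  ... | inj₂ (inj₂ xz)  = proper x z xz (trans sx≡su (sym sz))

  private
    covers : ∀ {u x} → DominatingPair G u x → ∀ y → colour y ≢ colour u → y ≢ x → Adjacent G u y
    covers {u} {x} dom y sy≢su y≢x with dom y
    ... | inj₁ (inj₁ y≡u) = ⊥-elim (sy≢su (cong colour y≡u))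
    ... | inj₁ (inj₂ uy)  = uy
    ... | inj₂ (inj₁ y≡x) = ⊥-elim (y≢x y≡x)
    ... | inj₂ (inj₂ xy)  = ⊥-elim (proper x y xy (≢-same⇒≡ (dominatingPair⇒opposite dom) sy≢su))

  dominatingPairs⇒universal : ∀ {u x₁ x₂} → x₁ ≢ x₂ → DominatingPair G u x₁ → DominatingPair G u x₂ →
                              Universal B u
  dominatingPairs⇒universal {x₁ = x₁} x₁≢x₂ dom₁ dom₂ y sy≢su with y ≟ x₁
  ... | yes refl = covers dom₂ y sy≢su x₁≢x₂
  ... | no y≢x₁  = covers dom₁ y sy≢su y≢x₁

  dominatingPair⇒universal : ∀ {u x} → Universal B u → DominatingPair G u x → Universal B x
  dominatingPair⇒universal {u} {x} universal-u dom y sy≢sx with dom y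
  ... | inj₁ (inj₁ refl) = trans (Graph.sym G x u) (universal-u x (dominatingPair⇒opposite dom))
  ... | inj₁ (inj₂ uy)   = ⊥-elim (proper u y uy (≢-same⇒≡ (dominatingPair⇒opposite dom ∘ sym) sy≢sx))
  ... | inj₂ (inj₁ refl) = ⊥-elim (sy≢sx refl)
  ... | inj₂ (inj₂ xy)   = xy

  -- Staller can block only one completion x₁ of Dominator's reply u, so there is a second one x₂;
  -- two partners of the opposite colour make u universal, and then u makes them universal.
  win₂⇒universal : SGameWinWithin G 2 → ∀ v →
                   ∃[ u ] (u ≢ v × Universal B u × UniversalPair B (not (colour u)))
  win₂⇒universal win v with win₂⇒winningReply G win v
  ... | u , u≢v , reply with winningReply⇒somePair G reply (¬dominatingVertex u)
  ... | x₁ , x₁≢u , x₁≢v , dom₁ with winningReply⇒pair G reply (¬dominatingVertex u) x₁≢u x₁≢v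
  ... | x₂ , _ , _ , x₂≢x₁ , dom₂ =
    u , u≢v , universal-u ,
    universalPair x₁ x₂ (x₂≢x₁ ∘ sym)
      (¬-not (dominatingPair⇒opposite dom₁)) (¬-not (dominatingPair⇒opposite dom₂))
      (dominatingPair⇒universal universal-u dom₁) (dominatingPair⇒universal universal-u dom₂)
    where
    universal-u : Universal B u
    universal-u = dominatingPairs⇒universal (x₂≢x₁ ∘ sym) dom₁ dom₂

  -- Applied a second time at the universal vertex u, the previous lemma yields a universal u′ ≠ u:
  -- either u′ shares u's colour, or its universal partners do.
  win₂⇒universalPairs : SGameWinWithin G 2 → ∀ σ → UniversalPair B σ
  win₂⇒universalPairs win with win₂⇒universal win (Three.x₁ (large true))
  ... | u , _ , universal-u , opposite with win₂⇒universal win u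
  ... | u′ , u′≢u , universal-u′ , opposite′ with colour u′ ≟ᵇ colour u
  ...   | yes same = by-colour (UniversalPair B)
                       (universalPair u u′ (u′≢u ∘ sym) refl same universal-u universal-u′) opposite
  ...   | no differ = by-colour (UniversalPair B)
                       (subst (UniversalPair B) (sym (¬-not (differ ∘ sym))) opposite′) opposite

-- Edge deletion and strategies for Staller

module _ (G : Graph) {u v : V G} (uv : Adjacent G u v) where
  private
    H = removeEdge G (u , v , uv)

  removeEdge-⊆ : ∀ {x y} → Adjacent H x y → Adjacent G x y
  removeEdge-⊆ {x} {y} = ∧-conicalˡ (Adj G x y) _

  removeEdge-keeps : ∀ {x y} → Adjacent G x y → ¬ (x ≡ u × y ≡ v) → ¬ (x ≡ v × y ≡ u) → Adjacent H x y
  removeEdge-keeps {x} {y} xy ¬uv ¬vu with Adj G x y | x ≟ u | y ≟ v | x ≟ v | y ≟ u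
  ... | false | _        | _        | _        | _        = xy
  ... | true  | yes x≡u  | yes y≡v  | _        | _        = ⊥-elim (¬uv (x≡u , y≡v))
  ... | true  | _        | _        | yes x≡v  | yes y≡u  = ⊥-elim (¬vu (x≡v , y≡u))
  ... | true  | no _     | _        | no _     | _        = refl
  ... | true  | no _     | _        | yes _    | no _     = refl
  ... | true  | yes _    | no _     | no _     | _        = refl
  ... | true  | yes _    | no _     | yes _    | no _     = refl

  removeEdge-removes : ¬ Adjacent H u v
  removeEdge-removes with Adj G u v | u ≟ u | v ≟ v
  ... | false | _       | _       = λ ()
  ... | true  | yes _   | yes _   = λ ()
  ... | true  | no u≢u  | _       = ⊥-elim (u≢u refl)
  ... | true  | yes _   | no v≢v  = ⊥-elim (v≢v refl)

  removeEdge-removes′ : ¬ Adjacent H v u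
  removeEdge-removes′ vu = removeEdge-removes (trans (Graph.sym H u v) vu)

  bipartition-removeEdge : Bipartition G → Bipartition H
  bipartition-removeEdge B = bipartition colour λ x y → proper x y ∘ removeEdge-⊆
    where open Bipartition B

  universal-removeEdge : ∀ B {h} → Universal B h → h ≢ u → h ≢ v → Universal (bipartition-removeEdge B) h
  universal-removeEdge B universal-h h≢u h≢v z sz≢sh =
    removeEdge-keeps (universal-h z sz≢sh) (h≢u ∘ proj₁) (h≢v ∘ proj₁)

module _ (G : Graph) where

  ¬dominatingPair : ∀ {u x} z → ¬ Dominates G u z → ¬ Dominates G x z → ¬ DominatingPair G u x
  ¬dominatingPair z ¬u ¬x dom = [ ¬u , ¬x ]′ (dom z)

  isolated⇒¬win₂ : ∀ z → (∀ y → ¬ Adjacent G z y) → ¬ SGameWinWithin G 2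
  isolated⇒¬win₂ z isolated win = refute (win₂⇒winningReply G win z)
    where
    undominated : ∀ {x} → x ≢ z → ¬ Dominates G x z
    undominated x≢z (inj₁ z≡x) = x≢z (sym z≡x)
    undominated {x} x≢z (inj₂ xz) = isolated x (trans (Graph.sym G z x) xz)

    refute : ∃[ u ] (u ≢ z × WinningReply G z u) → ⊥
    refute (u , u≢z , reply) with winningReply⇒somePair G reply (λ dom → undominated u≢z (dom z))
    ... | x , _ , x≢z , dom = ¬dominatingPair z (undominated u≢z) (undominated x≢z) dom

  -- Staller takes c and then any z ∉ {c, u}: only c and z themselves could dominate z.
  vertexCover⇒¬win₂ : ∀ c {y₁ y₂} → (∀ {x y} → Adjacent G x y → x ≡ c ⊎ y ≡ c) →
                      y₁ ≢ c → y₂ ≢ c → y₁ ≢ y₂ → ¬ SGameWinWithin G 2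
  vertexCover⇒¬win₂ c {y₁} {y₂} cover y₁≢c y₂≢c y₁≢y₂ win = refute (win₂⇒winningReply G win c)
    where
    undominated : ∀ {x z} → x ≢ c → z ≢ c → z ≢ x → ¬ Dominates G x z
    undominated x≢c z≢c z≢x (inj₁ z≡x) = z≢x z≡x
    undominated x≢c z≢c z≢x (inj₂ xz) = [ x≢c , z≢c ]′ (cover xz)

    other : ∀ u → ∃[ z ] (z ≢ c × z ≢ u)
    other u with y₁ ≟ u
    ... | yes refl = y₂ , y₂≢c , y₁≢y₂ ∘ sym
    ... | no y₁≢u  = y₁ , y₁≢c , y₁≢u

    refute : ∃[ u ] (u ≢ c × WinningReply G c u) → ⊥
    refute (u , u≢c , reply) with other u
    ... | z , z≢c , z≢u with winningReply⇒pair G reply (λ dom → undominated u≢c z≢c z≢u (dom z)) z≢u z≢c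
    ... | x , _ , x≢c , x≢z , dom =
      ¬dominatingPair z (undominated u≢c z≢c z≢u) (undominated x≢c z≢c (x≢z ∘ sym)) dom

module _ {G : Graph} (B : Bipartition G) where
  open Bipartition B

  -- Staller opens with b. If Dominator answers y she takes a, and a vertex of colour false other
  -- than y and Dominator's second vertex stays undominated; otherwise she takes y, whose only
  -- possible dominators b and y are then hers.
  missingSpoke⇒¬win₂ : ∀ {a b y} → a ≢ b → colour a ≡ true → colour b ≡ true →
                       (∀ x → colour x ≡ true → x ≡ a ⊎ x ≡ b) → Three (λ x → colour x ≡ false) →
                       colour y ≡ false → ¬ Adjacent G a y → ¬ SGameWinWithin G 2
  missingSpoke⇒¬win₂ {a} {b} {y} a≢b sa sb onlyAB falses sy ¬ay win = refute (win₂⇒winningReply G win b)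
    where
    spokeless : ∀ {x} → x ≢ b → x ≢ y → ¬ Dominates G x y
    spokeless x≢b x≢y (inj₁ y≡x) = x≢y (sym y≡x)
    spokeless {x} x≢b x≢y (inj₂ xy) with colour x in sx
    ... | false = proper x y xy (trans sx (sym sy))
    ... | true with onlyAB x sx
    ...   | inj₁ refl = ¬ay xy
    ...   | inj₂ x≡b  = x≢b x≡b

    false-colour : ∀ {x} → x ≢ a → x ≢ b → colour x ≡ false
    false-colour {x} x≢a x≢b = ¬-not λ sx → [ x≢a , x≢b ]′ (onlyAB x sx)

    refute : ∃[ u ] (u ≢ b × WinningReply G b u) → ⊥
    refute (u , u≢b , reply) with u ≟ y
    ... | no u≢y
      with winningReply⇒pair G reply (λ dom → spokeless u≢b u≢y (dom y)) (u≢y ∘ sym) (apart B sb sy ∘ sym)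
    ...   | x , _ , x≢b , x≢y , dom = ¬dominatingPair G y (spokeless u≢b u≢y) (spokeless x≢b x≢y) dom
    refute (u , u≢b , reply) | yes refl with avoidTwo falses y y
    ... | z , z≢y , _ , sz
      with winningReply⇒pair G reply (twin⇒¬dominatingVertex B z≢y (trans sz (sym sy))) (apart B sa sy) a≢b
    ...   | x , x≢y , x≢b , x≢a , dom with avoidTwo falses y x
    ...     | z′ , z′≢y , z′≢x , sz′ =
      ¬dominatingPair G z′ (twin⇒¬dominates B z′≢y (trans sz′ (sym sy)))
                           (twin⇒¬dominates B z′≢x (trans sz′ (sym (false-colour x≢a x≢b)))) dom

-- K_{2,m} and B_{n,m} are 2-critical

xor≡true⇒≢ : ∀ {a b} → a xor b ≡ true → a ≢ b
xor≡true⇒≢ {a} eq refl with trans (sym eq) (xor-same a)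
... | ()

≢⇒xor≡true : ∀ {a b} → a ≢ b → a xor b ≡ true
≢⇒xor≡true {false} {false} a≢b = ⊥-elim (a≢b refl)
≢⇒xor≡true {false} {true}  _   = refl
≢⇒xor≡true {true}  {false} _   = refl
≢⇒xor≡true {true}  {true}  a≢b = ⊥-elim (a≢b refl)

∨≡true⇒ : ∀ {a b} → a ∨ b ≡ true → a ≡ true ⊎ b ≡ true
∨≡true⇒ {true}  _  = inj₁ refl
∨≡true⇒ {false} eq = inj₂ eq

pairPigeonhole : ∀ {A : Set} {x y z p q : A} → x ≡ p ⊎ x ≡ q → y ≡ p ⊎ y ≡ q → z ≡ p ⊎ z ≡ q →
                 x ≢ y → x ≢ z → y ≢ z → ⊥
pairPigeonhole (inj₁ refl) (inj₁ refl) _           x≢y _   _   = x≢y refl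
pairPigeonhole (inj₂ refl) (inj₂ refl) _           x≢y _   _   = x≢y refl
pairPigeonhole (inj₁ refl) (inj₂ refl) (inj₁ refl) _   x≢z _   = x≢z refl
pairPigeonhole (inj₁ refl) (inj₂ refl) (inj₂ refl) _   _   y≢z = y≢z refl
pairPigeonhole (inj₂ refl) (inj₁ refl) (inj₁ refl) _   _   y≢z = y≢z refl
pairPigeonhole (inj₂ refl) (inj₁ refl) (inj₂ refl) _   x≢z _   = x≢z refl

record K2Structure (G : Graph) : Set where
  field
    colour   : V G → Bool
    adj      : ∀ x y → Adj G x y ≡ colour x xor colour y
    a b      : V G
    a≢b      : a ≢ b
    colour-a : colour a ≡ true
    colour-b : colour b ≡ true
    only-ab  : ∀ x → colour x ≡ true → x ≡ a ⊎ x ≡ b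
    falses   : Three (λ x → colour x ≡ false)

  bip : Bipartition G
  bip = bipartition colour λ x y xy → xor≡true⇒≢ (trans (sym (adj x y)) xy)

  universal : ∀ x → Universal bip x
  universal x y sy≢sx = trans (adj x y) (≢⇒xor≡true (sy≢sx ∘ sym))

  twin : ∀ u → ∃[ z ] (z ≢ u × colour z ≡ colour u)
  twin u with colour u in su
  ... | false with avoidTwo falses u u
  ...   | z , z≢u , _ , sz = z , z≢u , sz
  twin u | true with u ≟ a
  ...   | yes refl = b , a≢b ∘ sym , colour-b
  ...   | no u≢a   = a , u≢a ∘ sym , colour-a

k2Structure⇒critical : ∀ {G} → K2Structure G → Critical G 2
k2Structure⇒critical {G} K = critical₂-intro win₂ ¬win₁ ¬win₂-removeEdge
  where
  open K2Structure K
  open Bipartition bip using (proper)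

  pairs : ∀ σ → UniversalPair bip σ
  pairs true  = universalPair a b a≢b colour-a colour-b (universal a) (universal b)
  pairs false = universalPair x₁ x₂ x₁≢x₂ P₁ P₂ (universal x₁) (universal x₂)
    where open Three falses

  win₂ : SGameWinWithin G 2
  win₂ = universalPairs⇒win₂ bip pairs

  ¬win₁ : ¬ SGameWinWithin G 1
  ¬win₁ = noDominatingVertex⇒¬win₁ G a λ u → let z , z≢u , sz = twin u in twin⇒¬dominatingVertex bip z≢u sz

  spoke : ∀ e {t f} → ¬ Adjacent (removeEdge G e) t f → colour t ≡ true → colour f ≡ false →
          ¬ SGameWinWithin (removeEdge G e) 2
  spoke (x , y , xy) {t} ¬tf st sf with only-ab t st
  ... | inj₁ refl = missingSpoke⇒¬win₂ (bipartition-removeEdge G xy bip)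
                      a≢b colour-a colour-b only-ab falses sf ¬tf
  ... | inj₂ refl = missingSpoke⇒¬win₂ (bipartition-removeEdge G xy bip)
                      (a≢b ∘ sym) colour-b colour-a (λ x → swap ∘ only-ab x) falses sf ¬tf

  ¬win₂-removeEdge : ∀ e → ¬ SGameWinWithin (removeEdge G e) 2
  ¬win₂-removeEdge (x , y , xy) with colour x in sx
  ... | true  = spoke (x , y , xy) (removeEdge-removes G xy) sx (neighbour-colour bip sx xy)
  ... | false = spoke (x , y , xy) (removeEdge-removes′ G xy) (neighbour-colour bip sx xy) sx

-- colour separates the classes V₁, V₂ of B_{n,m}; hub₁ σ and hub₂ σ are the two vertices of full
-- degree in class σ, and rim σ is a third vertex of that class.
record BStructure (G : Graph) : Set where
  field
    colour hub    : V G → Bool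
    adj           : ∀ x y → Adj G x y ≡ (colour x xor colour y) ∧ (hub x ∨ hub y)
    hub₁ hub₂ rim : Bool → V G
    hub₁≢hub₂     : ∀ σ → hub₁ σ ≢ hub₂ σ
    colour-hub₁   : ∀ σ → colour (hub₁ σ) ≡ σ
    colour-hub₂   : ∀ σ → colour (hub₂ σ) ≡ σ
    colour-rim    : ∀ σ → colour (rim σ) ≡ σ
    hub-hub₁      : ∀ σ → hub (hub₁ σ) ≡ true
    hub-hub₂      : ∀ σ → hub (hub₂ σ) ≡ true
    hub-rim       : ∀ σ → hub (rim σ) ≡ false
    hub-unique    : ∀ x → hub x ≡ true → x ≡ hub₁ (colour x) ⊎ x ≡ hub₂ (colour x)

  bip : Bipartition G
  bip = bipartition colour λ x y xy → xor≡true⇒≢ (∧-conicalˡ _ _ (trans (sym (adj x y)) xy))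

  adjacent⇒hub : ∀ {x y} → Adjacent G x y → hub x ≡ true ⊎ hub y ≡ true
  adjacent⇒hub {x} {y} xy = ∨≡true⇒ (∧-conicalʳ _ _ (trans (sym (adj x y)) xy))

  rimNeighbour⇒hub : ∀ {x σ} → Adjacent G x (rim σ) → hub x ≡ true
  rimNeighbour⇒hub {σ = σ} xr = [ id , (λ hr → ⊥-elim (true≢false hr (hub-rim σ) refl)) ]′ (adjacent⇒hub xr)

  hub⇒universal : ∀ {x} → hub x ≡ true → Universal bip x
  hub⇒universal {x} hx y sy≢sx =
    trans (adj x y) (cong₂ _∧_ (≢⇒xor≡true (sy≢sx ∘ sym)) (cong (_∨ hub y) hx))

  atLeastThree : ∀ σ → Three (λ x → colour x ≡ σ)
  atLeastThree σ = three (hub₁ σ) (hub₂ σ) (rim σ) (hub₁≢hub₂ σ)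
    (hub≢rim (hub-hub₁ σ)) (hub≢rim (hub-hub₂ σ)) (colour-hub₁ σ) (colour-hub₂ σ) (colour-rim σ)
    where
    hub≢rim : ∀ {x} → hub x ≡ true → x ≢ rim σ
    hub≢rim hx = true≢false hx (hub-rim σ) ∘ cong hub

bStructure⇒critical : ∀ {G} → BStructure G → Critical G 2
bStructure⇒critical {G} S = critical₂-intro win₂ ¬win₁ ¬win₂-removeEdge
  where
  open BStructure S

  win₂ : SGameWinWithin G 2
  win₂ = universalPairs⇒win₂ bip λ σ →
    universalPair (hub₁ σ) (hub₂ σ) (hub₁≢hub₂ σ) (colour-hub₁ σ) (colour-hub₂ σ)
                  (hub⇒universal (hub-hub₁ σ)) (hub⇒universal (hub-hub₂ σ))

  ¬win₁ : ¬ SGameWinWithin G 1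
  ¬win₁ = noDominatingVertex⇒¬win₁ G (rim true) (LargeClasses.¬dominatingVertex bip atLeastThree)

  ¬win₂-removeEdge : ∀ e → ¬ SGameWinWithin (removeEdge G e) 2
  ¬win₂-removeEdge (x , y , xy) win =
    [ (λ hx → lostSpoke x y hx (Bipartition.proper bip x y xy ∘ sym) (removeEdge-removes G xy))
    , (λ hy → lostSpoke y x hy (Bipartition.proper bip x y xy) (removeEdge-removes′ G xy))
    ]′ (adjacent⇒hub xy)
    where
    H = removeEdge G (x , y , xy)
    B′ = bipartition-removeEdge G xy bip

    universal⇒hub : ∀ {z} → Universal B′ z → hub z ≡ true
    universal⇒hub {z} universal-z =
      rimNeighbour⇒hub (removeEdge-⊆ G xy (universal-z (rim (not (colour z))) opposite))
      where
      opposite : colour (rim (not (colour z))) ≢ colour z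
      opposite e = not-¬ refl (sym (trans (sym (colour-rim _)) e))

    -- The two universal vertices of h's class that G - e must have are hubs other than h.
    lostSpoke : ∀ h o → hub h ≡ true → colour o ≢ colour h → ¬ Adjacent H h o → ⊥
    lostSpoke h o hh so≢sh ¬ho with LargeClasses.win₂⇒universalPairs B′ atLeastThree win (colour h)
    ... | universalPair p q p≢q sp sq up uq =
      pairPigeonhole (isHub sp up) (isHub sq uq) (hub-unique h hh) p≢q (universal≢h up) (universal≢h uq)
      where
      isHub : ∀ {z} → colour z ≡ colour h → Universal B′ z → z ≡ hub₁ (colour h) ⊎ z ≡ hub₂ (colour h)
      isHub {z} sz uz = subst (λ σ → z ≡ hub₁ σ ⊎ z ≡ hub₂ σ) sz (hub-unique z (universal⇒hub uz))
      universal≢h : ∀ {z} → Universal B′ z → z ≢ h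
      universal≢h uz refl = ¬ho (uz o so≢sh)

-- A 2-critical connected bipartite graph is K_{2,m} or B_{n,m}

adjacent? : ∀ G x y → Dec (Adjacent G x y)
adjacent? G x y = Adj G x y ≟ᵇ true

module _ (G : Graph) where

  noNeighbour : ∀ {z w w′} → (∀ {x} → Adjacent G z x → x ≡ w ⊎ x ≡ w′) →
                ¬ Adjacent G z w → ¬ Adjacent G z w′ → ∀ x → ¬ Adjacent G z x
  noNeighbour neighbours ¬zw ¬zw′ x zx with neighbours zx
  ... | inj₁ refl = ¬zw zx
  ... | inj₂ refl = ¬zw′ zx

  -- Dominator answers v with its partner in the matching and threatens both ends of the other edge.
  perfectMatching⇒win₂ : ∀ {p p′ q q′} → Adjacent G p p′ → Adjacent G q q′ →
                         p ≢ q → p ≢ q′ → p′ ≢ q → p′ ≢ q′ →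
                         (∀ z → (z ≡ p ⊎ z ≡ p′) ⊎ (z ≡ q ⊎ z ≡ q′)) → SGameWinWithin G 2
  perfectMatching⇒win₂ {p} {p′} {q} {q′} pp′ qq′ p≢q p≢q′ p′≢q p′≢q′ cover = win₂-intro G p fork
    where
    forkAlong : ∀ {c v r r′} → Adjacent G c v → Adjacent G r r′ →
                (∀ z → (z ≡ c ⊎ z ≡ v) ⊎ (z ≡ r ⊎ z ≡ r′)) →
                r ≢ c → r′ ≢ c → r ≢ v → r′ ≢ v → Fork G v
    forkAlong {c} {v} {r} {r′} cv rr′ cover′ r≢c r′≢c r≢v r′≢v = record
      { centre = c ; x₁ = r ; x₂ = r′ ; centre≢v = adjacent⇒≢ G cv ; x₁≢x₂ = adjacent⇒≢ G rr′
      ; x₁≢centre = r≢c ; x₂≢centre = r′≢c ; x₁≢v = r≢v ; x₂≢v = r′≢v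
      ; dominating₁ = dominating (inj₁ refl) (inj₂ rr′)
      ; dominating₂ = dominating (inj₂ (adjacent-sym G rr′)) (inj₁ refl)
      }
      where
      dominating : ∀ {x} → Dominates G x r → Dominates G x r′ → DominatingPair G c x
      dominating xr xr′ z with cover′ z
      ... | inj₁ (inj₁ refl) = inj₁ (inj₁ refl)
      ... | inj₁ (inj₂ refl) = inj₁ (inj₂ cv)
      ... | inj₂ (inj₁ refl) = inj₂ xr
      ... | inj₂ (inj₂ refl) = inj₂ xr′

    fork : ∀ v → Fork G v
    fork v with cover v
    ... | inj₁ (inj₁ refl) = forkAlong (adjacent-sym G pp′) qq′ (map₁ swap ∘ cover)
                               (p′≢q ∘ sym) (p′≢q′ ∘ sym) (p≢q ∘ sym) (p≢q′ ∘ sym)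
    ... | inj₁ (inj₂ refl) = forkAlong pp′ qq′ cover
                               (p≢q ∘ sym) (p≢q′ ∘ sym) (p′≢q ∘ sym) (p′≢q′ ∘ sym)
    ... | inj₂ (inj₁ refl) = forkAlong (adjacent-sym G qq′) pp′ (map₁ swap ∘ swap ∘ cover)
                               p≢q′ p′≢q′ p≢q p′≢q
    ... | inj₂ (inj₂ refl) = forkAlong qq′ pp′ (swap ∘ cover) p≢q p′≢q p≢q′ p′≢q′

-- Two vertices a, b of colour true and two of colour false: without a perfect matching some vertex
-- is isolated; with one, connectivity gives a further edge, whose deletion keeps the matching and
-- hence Dominator's win.
module FourVertices {G : Graph} (B : Bipartition G) (connected : Connected G)
                    (¬win₂-removeEdge : ∀ e → ¬ SGameWinWithin (removeEdge G e) 2)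
                    {a b : V G} (a≢b : a ≢ b)
                    (sa : Bipartition.colour B a ≡ true) (sb : Bipartition.colour B b ≡ true)
                    (trues : ∀ x → Bipartition.colour B x ≡ true → x ≡ a ⊎ x ≡ b) where
  open Bipartition B

  module Matching {y y′} (y≢y′ : y ≢ y′) (sy : colour y ≡ false) (sy′ : colour y′ ≡ false)
                  (falses : ∀ x → colour x ≡ false → x ≡ y ⊎ x ≡ y′) where

    survives : ∀ e → Adjacent (removeEdge G e) a y → Adjacent (removeEdge G e) b y′ → ⊥
    survives e ay by′ = ¬win₂-removeEdge e
      (perfectMatching⇒win₂ (removeEdge G e) ay by′ a≢b (apart B sa sy′) (apart B sb sy ∘ sym) y≢y′ cover)
      where
      cover : ∀ z → (z ≡ a ⊎ z ≡ y) ⊎ (z ≡ b ⊎ z ≡ y′)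
      cover z with colour z in sz
      ... | true  = [ inj₁ ∘ inj₁ , inj₂ ∘ inj₁ ]′ (trues z sz)
      ... | false = [ inj₁ ∘ inj₂ , inj₂ ∘ inj₂ ]′ (falses z sz)

    matching⇒⊥ : Adjacent G a y → Adjacent G b y′ → ⊥
    matching⇒⊥ ay by′ with adjacent? G a y′ | adjacent? G b y
    ... | yes ay′ | _ = survives (a , y′ , ay′)
                          (removeEdge-keeps G ay′ ay (y≢y′ ∘ proj₂) (apart B sa sy′ ∘ proj₁))
                          (removeEdge-keeps G ay′ by′ (a≢b ∘ sym ∘ proj₁) (apart B sb sy′ ∘ proj₁))
    ... | no _ | yes by = survives (b , y , by)
                            (removeEdge-keeps G by ay (a≢b ∘ proj₁) (apart B sa sy ∘ proj₁))
                            (removeEdge-keeps G by by′ (y≢y′ ∘ sym ∘ proj₂) (apart B sb sy ∘ proj₁))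
    ... | no ¬ay′ | no ¬by with walk-closed G (λ z → z ≡ a ⊎ z ≡ y) closed (connected a b) (inj₁ refl)
      where
      closed : ∀ {x z} → x ≡ a ⊎ x ≡ y → Adjacent G x z → z ≡ a ⊎ z ≡ y
      closed (inj₁ refl) az with falses _ (neighbour-colour B sa az)
      ... | inj₁ z≡y  = inj₂ z≡y
      ... | inj₂ refl = ⊥-elim (¬ay′ az)
      closed (inj₂ refl) yz with trues _ (neighbour-colour B sy yz)
      ... | inj₁ z≡a  = inj₁ z≡a
      ... | inj₂ refl = ⊥-elim (¬by (adjacent-sym G yz))
    ... | inj₁ b≡a = a≢b (sym b≡a)
    ... | inj₂ b≡y = apart B sb sy b≡y

  fourVertices⇒⊥ : SGameWinWithin G 2 → ∀ {y₁ y₂} → y₁ ≢ y₂ → colour y₁ ≡ false → colour y₂ ≡ false →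
                   (∀ x → colour x ≡ false → x ≡ y₁ ⊎ x ≡ y₂) → ⊥
  fourVertices⇒⊥ win {y₁} {y₂} y₁≢y₂ sy₁ sy₂ falses
    with adjacent? G a y₁ | adjacent? G b y₂ | adjacent? G a y₂ | adjacent? G b y₁
  ... | yes ay₁ | yes by₂ | _       | _       = Matching.matching⇒⊥ y₁≢y₂ sy₁ sy₂ falses ay₁ by₂
  ... | _       | _       | yes ay₂ | yes by₁ =
    Matching.matching⇒⊥ (y₁≢y₂ ∘ sym) sy₂ sy₁ (λ x → swap ∘ falses x) ay₂ by₁
  ... | no ¬ay₁ | _       | no ¬ay₂ | _       =
    isolated⇒¬win₂ G a (noNeighbour G (falses _ ∘ neighbour-colour B sa) ¬ay₁ ¬ay₂) win
  ... | _       | no ¬by₂ | _       | no ¬by₁ =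
    isolated⇒¬win₂ G b (noNeighbour G (falses _ ∘ neighbour-colour B sb) ¬by₁ ¬by₂) win
  ... | no ¬ay₁ | _       | _       | no ¬by₁ =
    isolated⇒¬win₂ G y₁ (noNeighbour G (trues _ ∘ neighbour-colour B sy₁)
                                       (¬ay₁ ∘ adjacent-sym G) (¬by₁ ∘ adjacent-sym G)) win
  ... | _       | no ¬by₂ | no ¬ay₂ | _       =
    isolated⇒¬win₂ G y₂ (noNeighbour G (trues _ ∘ neighbour-colour B sy₂)
                                       (¬ay₂ ∘ adjacent-sym G) (¬by₂ ∘ adjacent-sym G)) win

module Critical₂ {G : Graph} (B : Bipartition G) (connected : Connected G) (critical : Critical G 2) where
  open Bipartition B

  win : SGameWinWithin G 2
  win = proj₁ (proj₁ critical)

  ¬win₁ : ¬ SGameWinWithin G 1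
  ¬win₁ = proj₂ (proj₁ critical) 1 (s≤s (s≤s z≤n))

  ¬win₀ : ¬ SGameWinWithin G 0
  ¬win₀ = proj₂ (proj₁ critical) 0 (s≤s z≤n)

  ¬win₂-removeEdge : ∀ e → ¬ SGameWinWithin (removeEdge G e) 2
  ¬win₂-removeEdge e = proj₂ critical e 2 ≤-refl

  monochrome⇒⊥ : ∀ z → (∀ x → colour x ≡ colour z) → ⊥
  monochrome⇒⊥ z mono = isolated⇒¬win₂ G z (λ x zx → proper z x zx (sym (mono x))) win

  singletonClass⇒vertexCover : ∀ {c σ} → (∀ x → colour x ≡ σ → x ≡ c) →
                               ∀ {x y} → Adjacent G x y → x ≡ c ⊎ y ≡ c
  singletonClass⇒vertexCover {σ = σ} only {x} {y} xy with colour x ≟ᵇ σ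
  ... | yes sx = inj₁ (only x sx)
  ... | no sx≢σ = inj₂ (only y (trans (neighbour-colour B (¬-not sx≢σ) xy) (not-involutive σ)))

  singletonClass⇒⊥ : ∀ {c σ y y′} → (∀ x → colour x ≡ σ → x ≡ c) → y ≢ c → y′ ≢ c → y ≢ y′ → ⊥
  singletonClass⇒⊥ only y≢c y′≢c y≢y′ =
    vertexCover⇒¬win₂ G _ (singletonClass⇒vertexCover only) y≢c y′≢c y≢y′ win

  singleEdge⇒win₁ : ∀ {a y} → Adjacent G a y → (∀ z → z ≡ a ⊎ z ≡ y) → SGameWinWithin G 1
  singleEdge⇒win₁ {a} {y} ay cover = win₁-intro G a answer
    where
    dominating : ∀ {u w} → Adjacent G u w → (∀ z → z ≡ u ⊎ z ≡ w) → DominatingVertex G u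
    dominating uw cover′ z = [ inj₁ , (λ { refl → inj₂ uw }) ]′ (cover′ z)
    answer : ∀ v → ∃[ u ] (u ≢ v × DominatingVertex G u)
    answer v with v ≟ a
    ... | yes refl = y , adjacent⇒≢ G ay ∘ sym , dominating (adjacent-sym G ay) (swap ∘ cover)
    ... | no v≢a   = a , v≢a ∘ sym , dominating ay cover

  twoHubs⇒k2Structure : ∀ {a b} → a ≢ b → colour a ≡ true → colour b ≡ true →
                        (∀ x → colour x ≡ true → x ≡ a ⊎ x ≡ b) → Three (λ x → colour x ≡ false) →
                        K2Structure G
  twoHubs⇒k2Structure {a} {b} a≢b sa sb trues falses = record
    { colour = colour ; adj = adj ; a = a ; b = b ; a≢b = a≢b ; colour-a = sa ; colour-b = sb
    ; only-ab = trues ; falses = falses }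
    where
    spoke : ∀ {x y} → colour x ≡ true → colour y ≡ false → Adjacent G x y
    spoke {x} {y} sx sy with trues x sx | adjacent? G a y | adjacent? G b y
    ... | inj₁ refl | yes ay | _      = ay
    ... | inj₂ refl | _      | yes by = by
    ... | inj₁ refl | no ¬ay | _      = ⊥-elim (missingSpoke⇒¬win₂ B a≢b sa sb trues falses sy ¬ay win)
    ... | inj₂ refl | _      | no ¬by =
      ⊥-elim (missingSpoke⇒¬win₂ B (a≢b ∘ sym) sb sa (λ z → swap ∘ trues z) falses sy ¬by win)

    adj : ∀ x y → Adj G x y ≡ colour x xor colour y
    adj x y with colour x in sx | colour y in sy
    ... | true  | true  = sameColour⇒¬adjacent B (trans sx (sym sy))
    ... | false | false = sameColour⇒¬adjacent B (trans sx (sym sy))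
    ... | true  | false = spoke sx sy
    ... | false | true  = adjacent-sym G (spoke sy sx)

  smallClass⇒k2Structure : AtMostTwo (λ x → colour x ≡ true) → K2Structure G
  smallClass⇒k2Structure (none ∄true) = ⊥-elim (monochrome⇒⊥ z λ x → trans (¬-not (∄true x)) (sym (¬-not (∄true z))))
    where z = ¬win₀⇒vertex G ¬win₀
  smallClass⇒k2Structure (one a sa onlyA) with census (λ x → colour x ≟ᵇ false)
  ... | inj₁ (none ∄false) = ⊥-elim (monochrome⇒⊥ a λ x → trans (¬-not (∄false x)) (sym sa))
  ... | inj₁ (one y sy onlyY) with adjacent? G a y
  ...   | yes ay = ⊥-elim (¬win₁ (singleEdge⇒win₁ ay cover))
    where
    cover : ∀ z → z ≡ a ⊎ z ≡ y
    cover z with colour z in sz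
    ... | true  = inj₁ (onlyA z sz)
    ... | false = inj₂ (onlyY z sz)
  ...   | no ¬ay = ⊥-elim (isolated⇒¬win₂ G a (noNeighbour G neighbour ¬ay ¬ay) win)
    where
    neighbour : ∀ {x} → Adjacent G a x → x ≡ y ⊎ x ≡ y
    neighbour ax = inj₁ (onlyY _ (neighbour-colour B sa ax))
  smallClass⇒k2Structure (one a sa onlyA) | inj₁ (two y y′ y≢y′ sy sy′ _) =
    ⊥-elim (singletonClass⇒⊥ onlyA (apart B sa sy ∘ sym) (apart B sa sy′ ∘ sym) y≢y′)
  smallClass⇒k2Structure (one a sa onlyA) | inj₂ (three y y′ _ y≢y′ _ _ sy sy′ _) =
    ⊥-elim (singletonClass⇒⊥ onlyA (apart B sa sy ∘ sym) (apart B sa sy′ ∘ sym) y≢y′)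
  smallClass⇒k2Structure (two a b a≢b sa sb trues) with census (λ x → colour x ≟ᵇ false)
  ... | inj₁ (none ∄false) = ⊥-elim (monochrome⇒⊥ a λ x → trans (¬-not (∄false x)) (sym sa))
  ... | inj₁ (one y sy onlyY) =
    ⊥-elim (singletonClass⇒⊥ onlyY (apart B sa sy) (apart B sb sy) a≢b)
  ... | inj₁ (two y₁ y₂ y₁≢y₂ sy₁ sy₂ falses) =
    ⊥-elim (FourVertices.fourVertices⇒⊥ B connected ¬win₂-removeEdge a≢b sa sb trues win y₁≢y₂ sy₁ sy₂ falses)
  ... | inj₂ falses = twoHubs⇒k2Structure a≢b sa sb trues falses

  universalPairs⇒bStructure : (∀ σ → Three (λ x → colour x ≡ σ)) → (∀ σ → UniversalPair B σ) → BStructure G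
  universalPairs⇒bStructure large pairs = record
    { colour = colour ; hub = hub ; adj = adj ; hub₁ = hub₁ ; hub₂ = hub₂ ; rim = rim
    ; hub₁≢hub₂ = λ σ → first≢second (pairs σ)
    ; colour-hub₁ = λ σ → colour-first (pairs σ) ; colour-hub₂ = λ σ → colour-second (pairs σ)
    ; colour-rim = λ σ → proj₂ (proj₂ (proj₂ (avoidHubs σ)))
    ; hub-hub₁ = λ σ → dec-true (isHub? _) (hub₁-isHub σ)
    ; hub-hub₂ = λ σ → dec-true (isHub? _) (hub₂-isHub σ)
    ; hub-rim = λ σ → dec-false (isHub? _) (rim-¬isHub σ)
    ; hub-unique = hub-unique
    }
    where
    open UniversalPair

    hub₁ hub₂ rim : Bool → V G
    hub₁ σ = first (pairs σ)
    hub₂ σ = second (pairs σ)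

    IsHub : V G → Set
    IsHub x = x ≡ hub₁ (colour x) ⊎ x ≡ hub₂ (colour x)

    isHub? : ∀ x → Dec (IsHub x)
    isHub? x = (x ≟ hub₁ (colour x)) ⊎-dec (x ≟ hub₂ (colour x))

    hub : V G → Bool
    hub x = does (isHub? x)

    hub₁-isHub : ∀ σ → IsHub (hub₁ σ)
    hub₁-isHub σ = inj₁ (cong hub₁ (sym (colour-first (pairs σ))))

    hub₂-isHub : ∀ σ → IsHub (hub₂ σ)
    hub₂-isHub σ = inj₂ (cong hub₂ (sym (colour-second (pairs σ))))

    avoidHubs : ∀ σ → ∃[ z ] (z ≢ hub₁ σ × z ≢ hub₂ σ × colour z ≡ σ)
    avoidHubs σ = avoidTwo (large σ) (hub₁ σ) (hub₂ σ)

    rim σ = proj₁ (avoidHubs σ)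

    rim-¬isHub : ∀ σ → ¬ IsHub (rim σ)
    rim-¬isHub σ with avoidHubs σ
    ... | z , z≢h₁ , z≢h₂ , refl = [ z≢h₁ , z≢h₂ ]′

    hub-unique : ∀ x → hub x ≡ true → IsHub x
    hub-unique x = decided (isHub? x)

    isHub⇒universal : ∀ {x} → IsHub x → Universal B x
    isHub⇒universal {x} (inj₁ x≡h₁) = subst (Universal B) (sym x≡h₁) (universal-first (pairs (colour x)))
    isHub⇒universal {x} (inj₂ x≡h₂) = subst (Universal B) (sym x≡h₂) (universal-second (pairs (colour x)))

    -- Deleting an edge between non-hubs would keep the four universal vertices.
    touchesHub : ∀ {x y} → Adjacent G x y → IsHub x ⊎ IsHub y
    touchesHub {x} {y} xy with isHub? x | isHub? y
    ... | yes hx  | _       = inj₁ hx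
    ... | no _    | yes hy  = inj₂ hy
    ... | no ¬hx  | no ¬hy  = ⊥-elim (¬win₂-removeEdge (x , y , xy) (universalPairs⇒win₂ B′ pairs′))
      where
      B′ = bipartition-removeEdge G xy B
      avoids : ∀ {z w} → IsHub z → ¬ IsHub w → z ≢ w
      avoids hz ¬hw refl = ¬hw hz
      pairs′ : ∀ σ → UniversalPair B′ σ
      pairs′ σ = universalPair (hub₁ σ) (hub₂ σ) (first≢second (pairs σ))
        (colour-first (pairs σ)) (colour-second (pairs σ))
        (universal-removeEdge G xy B (universal-first (pairs σ))
                              (avoids (hub₁-isHub σ) ¬hx) (avoids (hub₁-isHub σ) ¬hy))
        (universal-removeEdge G xy B (universal-second (pairs σ))
                              (avoids (hub₂-isHub σ) ¬hx) (avoids (hub₂-isHub σ) ¬hy))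

    hubEdge : ∀ {x y} → colour x ≢ colour y → hub x ∨ hub y ≡ true → Adjacent G x y
    hubEdge {x} {y} sx≢sy hxy with ∨≡true⇒ hxy
    ... | inj₁ hx = isHub⇒universal (hub-unique x hx) y (sx≢sy ∘ sym)
    ... | inj₂ hy = adjacent-sym G (isHub⇒universal (hub-unique y hy) x sx≢sy)

    adj : ∀ x y → Adj G x y ≡ (colour x xor colour y) ∧ (hub x ∨ hub y)
    adj x y with Adj G x y in xy
    ... | true  = sym (cong₂ _∧_ (≢⇒xor≡true (proper x y xy)) ([ hub-true , hub-true′ ]′ (touchesHub xy)))
      where
      hub-true : IsHub x → hub x ∨ hub y ≡ true
      hub-true hx = cong (_∨ hub y) (dec-true (isHub? x) hx)
      hub-true′ : IsHub y → hub x ∨ hub y ≡ true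
      hub-true′ hy = trans (cong (hub x ∨_) (dec-true (isHub? y) hy)) (∨-zeroʳ (hub x))
    ... | false = sym (¬-not λ formula → not-¬ (hubEdge (xor≡true⇒≢ (∧-conicalˡ _ _ formula))
                                                        (∧-conicalʳ _ _ formula)) xy)

critical⇒structure : ∀ {G} → Connected G → Bipartition G → Critical G 2 → K2Structure G ⊎ BStructure G
critical⇒structure {G} connected B@(bipartition colour _) critical with census (λ x → colour x ≟ᵇ true)
... | inj₁ small = inj₁ (Critical₂.smallClass⇒k2Structure B connected critical small)
... | inj₂ trues with census (λ x → not (colour x) ≟ᵇ true)
...   | inj₁ small = inj₁ (Critical₂.smallClass⇒k2Structure (swapColours B) connected critical small)
...   | inj₂ falses = inj₂ (universalPairs⇒bStructure large (LargeClasses.win₂⇒universalPairs B large win))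
  where
  open Critical₂ B connected critical
  large : ∀ σ → Three (λ x → colour x ≡ σ)
  large true  = trues
  large false = Three-map (λ nx → trans (sym (not-involutive _)) (cong not nx)) falses

-- Relabelling the vertices as in K2 m and B p q

open Inverse using (to; from; strictlyInverseˡ; strictlyInverseʳ; inverseʳ)

isLeft : ∀ {A B : Set} → A ⊎ B → Bool
isLeft (inj₁ _) = true
isLeft (inj₂ _) = false

module _ {A B C D : Set} where

  isLeft-map : ∀ {f : A → C} {g : B → D} w → isLeft (map f g w) ≡ isLeft w
  isLeft-map (inj₁ _) = refl
  isLeft-map (inj₂ _) = refl

isLeft-swap-map₁ : ∀ {A B C : Set} {f : B → C} (w : A ⊎ B) → isLeft (swap (map₁ f (swap w))) ≡ isLeft w
isLeft-swap-map₁ (inj₁ _) = refl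
isLeft-swap-map₁ (inj₂ _) = refl

isLeft⇒inj₁ : ∀ {A B : Set} {w : A ⊎ B} → isLeft w ≡ true → ∃[ a ] (w ≡ inj₁ a)
isLeft⇒inj₁ {w = inj₁ a} _ = a , refl

¬isLeft⇒inj₂ : ∀ {A B : Set} {w : A ⊎ B} → isLeft w ≡ false → ∃[ b ] (w ≡ inj₂ b)
¬isLeft⇒inj₂ {w = inj₂ b} _ = b , refl

consˡ : ∀ {N p q} → Fin N ↔ (Fin p ⊎ Fin q) → Fin (suc N) ↔ (Fin (suc p) ⊎ Fin q)
consˡ {N} {p} {q} φ = mk↔ₛ′ forth back forth∘back back∘forth
  where
  forth : Fin (suc N) → Fin (suc p) ⊎ Fin q
  forth zero    = inj₁ zero
  forth (suc x) = map₁ suc (to φ x)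

  back : Fin (suc p) ⊎ Fin q → Fin (suc N)
  back (inj₁ zero)    = zero
  back (inj₁ (suc i)) = suc (from φ (inj₁ i))
  back (inj₂ j)       = suc (from φ (inj₂ j))

  forth∘back : ∀ w → forth (back w) ≡ w
  forth∘back (inj₁ zero)    = refl
  forth∘back (inj₁ (suc i)) = cong (map₁ suc) (strictlyInverseˡ φ (inj₁ i))
  forth∘back (inj₂ j)       = cong (map₁ suc) (strictlyInverseˡ φ (inj₂ j))

  back-map₁ : ∀ w → back (map₁ suc w) ≡ suc (from φ w)
  back-map₁ (inj₁ _) = refl
  back-map₁ (inj₂ _) = refl

  back∘forth : ∀ x → back (forth x) ≡ x
  back∘forth zero    = refl
  back∘forth (suc x) = trans (back-map₁ (to φ x)) (cong suc (strictlyInverseʳ φ x))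

consʳ : ∀ {N p q} → Fin N ↔ (Fin p ⊎ Fin q) → Fin (suc N) ↔ (Fin p ⊎ Fin (suc q))
consʳ φ = ⊎-comm _ _ ↔-∘ consˡ (⊎-comm _ _ ↔-∘ φ)

record Partition {N} (f : Fin N → Bool) : Set where
  field
    #left #right : ℕ
    split        : Fin N ↔ (Fin #left ⊎ Fin #right)
    isLeft-split : ∀ x → isLeft (to split x) ≡ f x

partition : ∀ {N} (f : Fin N → Bool) → Partition f
partition {zero} f = record { #left = 0 ; #right = 0 ; split = +↔⊎ ; isLeft-split = λ () }
partition {suc N} f with partition (f ∘ suc) | f zero in f₀
... | P | true = record
  { #left = suc #left ; #right = #right ; split = consˡ split
  ; isLeft-split = λ { zero → sym f₀ ; (suc x) → trans (isLeft-map (to split x)) (isLeft-split x) } }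
  where open Partition P
... | P | false = record
  { #left = #left ; #right = suc #right ; split = consʳ split
  ; isLeft-split = λ { zero → sym f₀ ; (suc x) → trans (isLeft-swap-map₁ (to split x)) (isLeft-split x) } }
  where open Partition P

exactlyTwo : ∀ {p} {α β : Fin p} → α ≢ β → (∀ i → i ≡ α ⊎ i ≡ β) → Fin p ↔ Fin 2
exactlyTwo {p} {α} {β} α≢β only = mk↔ₛ′ forth back forth∘back back∘forth
  where
  forth : Fin p → Fin 2
  forth i with i ≟ α
  ... | yes _ = zero
  ... | no _  = suc zero

  back : Fin 2 → Fin p
  back zero       = α
  back (suc zero) = β

  forth∘back : ∀ j → forth (back j) ≡ j
  forth∘back zero with α ≟ α
  ... | yes _   = refl
  ... | no α≢α  = ⊥-elim (α≢α refl)
  forth∘back (suc zero) with β ≟ α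
  ... | yes β≡α = ⊥-elim (α≢β (sym β≡α))
  ... | no _    = refl

  back∘forth : ∀ i → back (forth i) ≡ i
  back∘forth i with i ≟ α
  ... | yes i≡α = sym i≡α
  ... | no i≢α  = [ ⊥-elim ∘ i≢α , sym ]′ (only i)

inhabited⇒1≤ : ∀ {k} → Fin k → 1 ≤ k
inhabited⇒1≤ zero    = s≤s z≤n
inhabited⇒1≤ (suc _) = s≤s z≤n

distinct₂⇒2≤ : ∀ {k} {i j : Fin k} → i ≢ j → 2 ≤ k
distinct₂⇒2≤ {suc k} i≢j = s≤s (inhabited⇒1≤ (punchOut i≢j))

distinct₃⇒3≤ : ∀ {k} {i j l : Fin k} → i ≢ j → i ≢ l → j ≢ l → 3 ≤ k
distinct₃⇒3≤ {suc k} i≢j i≢l j≢l = s≤s (distinct₂⇒2≤ (j≢l ∘ punchOut-injective i≢j i≢l))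

module PartitionProperties {N} {f : Fin N → Bool} (P : Partition f) where
  open Partition P

  leftIndex : ∀ {x} → f x ≡ true → ∃[ i ] (from split (inj₁ i) ≡ x)
  leftIndex {x} fx with isLeft⇒inj₁ (trans (isLeft-split x) fx)
  ... | i , split-x = i , inverseʳ split (sym split-x)

  rightIndex : ∀ {x} → f x ≡ false → ∃[ j ] (from split (inj₂ j) ≡ x)
  rightIndex {x} fx with ¬isLeft⇒inj₂ (trans (isLeft-split x) fx)
  ... | j , split-x = j , inverseʳ split (sym split-x)

  from-injective : ∀ {w w′} → from split w ≡ from split w′ → w ≡ w′
  from-injective = Injection.injective (↔⇒↣ (↔-sym split))

  f-left : ∀ i → f (from split (inj₁ i)) ≡ true
  f-left i = trans (sym (isLeft-split _)) (cong isLeft (strictlyInverseˡ split (inj₁ i)))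

  f-right : ∀ j → f (from split (inj₂ j)) ≡ false
  f-right j = trans (sym (isLeft-split _)) (cong isLeft (strictlyInverseˡ split (inj₂ j)))

  leftPair : ∀ {a b} → a ≢ b → f a ≡ true → f b ≡ true → (∀ x → f x ≡ true → x ≡ a ⊎ x ≡ b) →
             Fin #left ↔ Fin 2
  leftPair {a} {b} a≢b fa fb only with leftIndex fa | leftIndex fb
  ... | α , ι-α | β , ι-β = exactlyTwo α≢β onlyαβ
    where
    α≢β : α ≢ β
    α≢β refl = a≢b (trans (sym ι-α) ι-β)
    onlyαβ : ∀ i → i ≡ α ⊎ i ≡ β
    onlyαβ i with only _ (f-left i)
    ... | inj₁ ι-i≡a = inj₁ (inj₁-injective (from-injective (trans ι-i≡a (sym ι-α))))
    ... | inj₂ ι-i≡b = inj₂ (inj₁-injective (from-injective (trans ι-i≡b (sym ι-β))))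

  threeRight⇒3≤ : Three (λ x → f x ≡ false) → 3 ≤ #right
  threeRight⇒3≤ (three x₁ x₂ x₃ x₁≢x₂ x₁≢x₃ x₂≢x₃ f₁ f₂ f₃)
    with rightIndex f₁ | rightIndex f₂ | rightIndex f₃
  ... | j₁ , ι₁ | j₂ , ι₂ | j₃ , ι₃ =
    distinct₃⇒3≤ (indices≢ x₁≢x₂ ι₁ ι₂) (indices≢ x₁≢x₃ ι₁ ι₃) (indices≢ x₂≢x₃ ι₂ ι₃)
    where
    indices≢ : ∀ {x y j j′} → x ≢ y → from split (inj₂ j) ≡ x → from split (inj₂ j′) ≡ y → j ≢ j′
    indices≢ x≢y ι-x ι-y refl = x≢y (trans (sym ι-x) ι-y)

↑ˡ-<ᵇ : ∀ {p} q (i : Fin p) → (toℕ (i ↑ˡ q) <ᵇ p) ≡ true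
↑ˡ-<ᵇ q zero    = refl
↑ˡ-<ᵇ q (suc i) = ↑ˡ-<ᵇ q i

↑ʳ-<ᵇ : ∀ p {q} (j : Fin q) → (toℕ (p ↑ʳ j) <ᵇ p) ≡ false
↑ʳ-<ᵇ zero    j = refl
↑ʳ-<ᵇ (suc p) j = ↑ʳ-<ᵇ p j

join-<ᵇ : ∀ p q w → (toℕ (join p q w) <ᵇ p) ≡ isLeft w
join-<ᵇ p q (inj₁ i) = ↑ˡ-<ᵇ q i
join-<ᵇ p q (inj₂ j) = ↑ʳ-<ᵇ p j

-- In B p q the hubs of a colour class occupy its first two positions.
markedPairFirst : ∀ {p} (h : Fin p → Bool) {α β ρ} → α ≢ β → h α ≡ true → h β ≡ true → h ρ ≡ false →
            (∀ i → h i ≡ true → i ≡ α ⊎ i ≡ β) →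
            ∃[ k ] (3 ≤ 2 + k × Σ (Fin p ↔ Fin (2 + k)) λ ψ → ∀ i → (toℕ (to ψ i) <ᵇ 2) ≡ h i)
markedPairFirst h α≢β hα hβ hρ only = #right , s≤s (s≤s (inhabited⇒1≤ (proj₁ (rightIndex hρ)))) , ψ , front
  where
  P = partition h
  open Partition P
  open PartitionProperties P

  ψ : Fin _ ↔ Fin (2 + #right)
  ψ = ↔-sym +↔⊎ ↔-∘ ((leftPair α≢β hα hβ only ⊎-↔ ↔-id _) ↔-∘ split)

  front : ∀ i → (toℕ (to ψ i) <ᵇ 2) ≡ h i
  front i = trans (join-<ᵇ 2 #right _) (trans (isLeft-map (to split i)) (isLeft-split i))

inFront : ∀ {p q} → Fin p ⊎ Fin q → Bool
inFront = [ (λ i → toℕ i <ᵇ 2) , (λ j → toℕ j <ᵇ 2) ]′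

join-hub : ∀ p q w →
           ((if toℕ (join p q w) <ᵇ p then toℕ (join p q w) else toℕ (join p q w) ∸ p) <ᵇ 2) ≡ inFront w
join-hub p q (inj₁ i) rewrite ↑ˡ-<ᵇ q i = cong (_<ᵇ 2) (toℕ-↑ˡ i q)
join-hub p q (inj₂ j) rewrite ↑ʳ-<ᵇ p j =
  cong (_<ᵇ 2) (trans (cong (_∸ p) (toℕ-↑ʳ p j)) (m+n∸m≡n p (toℕ j)))

blockAdj : ∀ {p q} → Fin p ⊎ Fin q → Fin p ⊎ Fin q → Bool
blockAdj w w′ = (isLeft w xor isLeft w′) ∧ (inFront w ∨ inFront w′)

B-join : ∀ p q w w′ → Adj (B p q) (join p q w) (join p q w′) ≡ blockAdj w w′
B-join p q w w′ =
  cong₂ _∧_ (cong₂ _xor_ (join-<ᵇ p q w) (join-<ᵇ p q w′)) (cong₂ _∨_ (join-hub p q w) (join-hub p q w′))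

K2-join : ∀ m w w′ → Adj (K2 m) (join 2 m w) (join 2 m w′) ≡ isLeft w xor isLeft w′
K2-join m w w′ = cong₂ _xor_ (join-<ᵇ 2 m w) (join-<ᵇ 2 m w′)

module _ {G : Graph} {p q : ℕ} (A : Fin (p + q) → Fin (p + q) → Bool) where

  blocks⇒iso : (φ : V G ↔ (Fin p ⊎ Fin q)) → (∀ x y → Adj G x y ≡ A (join p q (to φ x)) (join p q (to φ y))) →
               Σ (V G ↔ Fin (p + q)) λ f → ∀ x y → Adj G x y ≡ A (to f x) (to f y)
  blocks⇒iso φ adj = ↔-sym +↔⊎ ↔-∘ φ , adj

  iso⇒blocks : (Σ (V G ↔ Fin (p + q)) λ f → ∀ x y → Adj G x y ≡ A (to f x) (to f y)) →
               Σ (V G ↔ (Fin p ⊎ Fin q)) λ φ → ∀ x y → Adj G x y ≡ A (join p q (to φ x)) (join p q (to φ y))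
  iso⇒blocks (f , adj) = +↔⊎ ↔-∘ f , λ x y →
    trans (adj x y) (sym (cong₂ A (join-splitAt p q (to f x)) (join-splitAt p q (to f y))))

k2Structure⇒≅K2 : ∀ {G} → K2Structure G → ∃[ m ] (3 ≤ m × G ≅ K2 m)
k2Structure⇒≅K2 {G} K = #right , threeRight⇒3≤ falses , blocks⇒iso {G} {2} {#right} (Adj (K2 #right)) φ adjφ
  where
  open K2Structure K
  P = partition colour
  open Partition P
  open PartitionProperties P

  φ : V G ↔ (Fin 2 ⊎ Fin #right)
  φ = (leftPair a≢b colour-a colour-b only-ab ⊎-↔ ↔-id _) ↔-∘ split

  colour≡ : ∀ x → colour x ≡ isLeft (to φ x)
  colour≡ x = sym (trans (isLeft-map (to split x)) (isLeft-split x))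

  adjφ : ∀ x y → Adj G x y ≡ Adj (K2 #right) (join 2 #right (to φ x)) (join 2 #right (to φ y))
  adjφ x y = trans (adj x y)
                   (trans (cong₂ _xor_ (colour≡ x) (colour≡ y)) (sym (K2-join #right (to φ x) (to φ y))))

module Blocks {G : Graph} {p q : ℕ} (φ : V G ↔ (Fin p ⊎ Fin q)) where

  block≢ : ∀ {w w′} → w ≢ w′ → from φ w ≢ from φ w′
  block≢ w≢w′ = w≢w′ ∘ Injection.injective (↔⇒↣ (↔-sym φ))

  ≡block : ∀ {x w} → to φ x ≡ w → x ≡ from φ w
  ≡block e = sym (inverseʳ φ (sym e))

  isLeft-block : ∀ w → isLeft (to φ (from φ w)) ≡ isLeft w
  isLeft-block w = cong isLeft (strictlyInverseˡ φ w)

blocks⇒k2Structure : ∀ {G m} (φ : V G ↔ (Fin 2 ⊎ Fin (3 + m))) →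
                     (∀ x y → Adj G x y ≡ isLeft (to φ x) xor isLeft (to φ y)) → K2Structure G
blocks⇒k2Structure {G} φ adj = record
  { colour = colour ; adj = adj ; a = from φ (inj₁ zero) ; b = from φ (inj₁ (suc zero))
  ; a≢b = block≢ λ () ; colour-a = isLeft-block _ ; colour-b = isLeft-block _ ; only-ab = only-ab
  ; falses = three (from φ (inj₂ zero)) (from φ (inj₂ (suc zero))) (from φ (inj₂ (suc (suc zero))))
                   (block≢ λ ()) (block≢ λ ()) (block≢ λ ())
                   (isLeft-block _) (isLeft-block _) (isLeft-block _)
  }
  where
  open Blocks {G} φ

  colour : V G → Bool
  colour x = isLeft (to φ x)

  only-ab : ∀ x → isLeft (to φ x) ≡ true → x ≡ from φ (inj₁ zero) ⊎ x ≡ from φ (inj₁ (suc zero))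
  only-ab x left with to φ x in e
  ... | inj₁ zero       = inj₁ (≡block e)
  ... | inj₁ (suc zero) = inj₂ (≡block e)

≅K2⇒k2Structure : ∀ {G m} → 3 ≤ m → G ≅ K2 m → K2Structure G
≅K2⇒k2Structure {G} {suc (suc (suc m))} (s≤s (s≤s (s≤s _))) iso =
  blocks⇒k2Structure φ λ x y → trans (adj x y) (K2-join _ (to φ x) (to φ y))
  where
  blocks = iso⇒blocks {G} {2} {3 + m} (Adj (K2 (3 + m))) iso
  φ = proj₁ blocks
  adj = proj₂ blocks

blocks⇒bStructure : ∀ {G p q} (φ : V G ↔ (Fin (3 + p) ⊎ Fin (3 + q))) →
                    (∀ x y → Adj G x y ≡ blockAdj (to φ x) (to φ y)) → BStructure G
blocks⇒bStructure {G} {p} {q} φ adj = record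
  { colour = λ x → isLeft (to φ x) ; hub = λ x → inFront (to φ x) ; adj = adj
  ; hub₁ = λ σ → at σ zero ; hub₂ = λ σ → at σ (suc zero) ; rim = λ σ → at σ (suc (suc zero))
  ; hub₁≢hub₂ = λ { true → block≢ λ () ; false → block≢ λ () }
  ; colour-hub₁ = λ σ → colour-at σ _ ; colour-hub₂ = λ σ → colour-at σ _ ; colour-rim = λ σ → colour-at σ _
  ; hub-hub₁ = λ { true → inFront-at true _ ; false → inFront-at false _ }
  ; hub-hub₂ = λ { true → inFront-at true _ ; false → inFront-at false _ }
  ; hub-rim = λ { true → inFront-at true _ ; false → inFront-at false _ }
  ; hub-unique = hub-unique
  }
  where
  open Blocks {G} φ

  slot : Bool → Fin 3 → Fin (3 + p) ⊎ Fin (3 + q)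
  slot true  i = inj₁ (i ↑ˡ p)
  slot false i = inj₂ (i ↑ˡ q)

  at : Bool → Fin 3 → V G
  at σ i = from φ (slot σ i)

  colour-at : ∀ σ i → isLeft (to φ (at σ i)) ≡ σ
  colour-at true  i = isLeft-block (slot true i)
  colour-at false i = isLeft-block (slot false i)

  inFront-at : ∀ σ i → inFront (to φ (at σ i)) ≡ inFront (slot σ i)
  inFront-at σ i = cong inFront (strictlyInverseˡ φ (slot σ i))

  hub-unique : ∀ x → inFront (to φ x) ≡ true →
               x ≡ at (isLeft (to φ x)) zero ⊎ x ≡ at (isLeft (to φ x)) (suc zero)
  hub-unique x hx with to φ x in e
  ... | inj₁ zero       = inj₁ (≡block e)
  ... | inj₁ (suc zero) = inj₂ (≡block e)
  ... | inj₂ zero       = inj₁ (≡block e)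
  ... | inj₂ (suc zero) = inj₂ (≡block e)

≅B⇒bStructure : ∀ {G p q} → 3 ≤ p → 3 ≤ q → G ≅ B p q → BStructure G
≅B⇒bStructure {G} {suc (suc (suc p))} {suc (suc (suc q))} (s≤s (s≤s (s≤s _))) (s≤s (s≤s (s≤s _))) iso =
  blocks⇒bStructure φ λ x y → trans (adj x y) (B-join _ _ (to φ x) (to φ y))
  where
  blocks = iso⇒blocks {G} {3 + p} {3 + q} (Adj (B (3 + p) (3 + q))) iso
  φ = proj₁ blocks
  adj = proj₂ blocks

module _ {G : Graph} (S : BStructure G) where
  open BStructure S

  hubsFirst : ∀ {k} (ι : Fin k → V G) → (∀ {i j} → ι i ≡ ι j → i ≡ j) → ∀ σ →
              (∀ {x} → colour x ≡ σ → ∃[ i ] (ι i ≡ x)) → (∀ i → colour (ι i) ≡ σ) →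
              ∃[ k′ ] (3 ≤ 2 + k′ × Σ (Fin k ↔ Fin (2 + k′)) λ ψ → ∀ i → (toℕ (to ψ i) <ᵇ 2) ≡ hub (ι i))
  hubsFirst ι ι-injective σ onto colour-ι
    with onto (colour-hub₁ σ) | onto (colour-hub₂ σ) | onto (colour-rim σ)
  ... | α , ι-α | β , ι-β | ρ , ι-ρ =
    markedPairFirst (hub ∘ ι) α≢β (trans (cong hub ι-α) (hub-hub₁ σ)) (trans (cong hub ι-β) (hub-hub₂ σ))
              (trans (cong hub ι-ρ) (hub-rim σ)) only
    where
    α≢β : α ≢ β
    α≢β refl = hub₁≢hub₂ σ (trans (sym ι-α) ι-β)
    only : ∀ i → hub (ι i) ≡ true → i ≡ α ⊎ i ≡ β
    only i hi with hub-unique (ι i) hi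
    ... | inj₁ e = inj₁ (ι-injective (trans e (trans (cong hub₁ (colour-ι i)) (sym ι-α))))
    ... | inj₂ e = inj₂ (ι-injective (trans e (trans (cong hub₂ (colour-ι i)) (sym ι-β))))

  private
    P = partition colour
  open Partition P
  open PartitionProperties P

  bStructure⇒≅B : ∃[ p ] ∃[ q ] (3 ≤ p × 3 ≤ q × G ≅ B p q)
  bStructure⇒≅B with hubsFirst (from split ∘ inj₁) (inj₁-injective ∘ from-injective) true leftIndex f-left
                   | hubsFirst (from split ∘ inj₂) (inj₂-injective ∘ from-injective) false rightIndex f-right
  ... | k , 3≤k , ψL , frontL | l , 3≤l , ψR , frontR =
    2 + k , 2 + l , 3≤k , 3≤l , blocks⇒iso {G} {2 + k} {2 + l} (Adj (B (2 + k) (2 + l))) φ adjφ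
    where
    φ : V G ↔ (Fin (2 + k) ⊎ Fin (2 + l))
    φ = (ψL ⊎-↔ ψR) ↔-∘ split

    colour≡ : ∀ x → colour x ≡ isLeft (to φ x)
    colour≡ x = sym (trans (isLeft-map (to split x)) (isLeft-split x))

    hub≡ : ∀ x → hub x ≡ inFront (map (to ψL) (to ψR) (to split x))
    hub≡ x with to split x in e
    ... | inj₁ i = sym (trans (frontL i) (cong hub (inverseʳ split (sym e))))
    ... | inj₂ j = sym (trans (frontR j) (cong hub (inverseʳ split (sym e))))

    adjφ : ∀ x y → Adj G x y ≡ Adj (B (2 + k) (2 + l)) (join _ _ (to φ x)) (join _ _ (to φ y))
    adjφ x y = trans (adj x y)
                     (trans (cong₂ _∧_ (cong₂ _xor_ (colour≡ x) (colour≡ y)) (cong₂ _∨_ (hub≡ x) (hub≡ y)))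
                            (sym (B-join _ _ (to φ x) (to φ y))))

theorem4p7 : (G : Graph) → Connected G → Bipartite G →
    (Critical G 2 ⇔
      ((∃[ m ] (3 ≤ m × G ≅ K2 m)) ⊎ (∃[ p ] ∃[ q ] (3 ≤ p × 3 ≤ q × G ≅ B p q))))
theorem4p7 G connected (colour , proper) = mk⇔ forward backward
  where
  forward : Critical G 2 → (∃[ m ] (3 ≤ m × G ≅ K2 m)) ⊎ (∃[ p ] ∃[ q ] (3 ≤ p × 3 ≤ q × G ≅ B p q))
  forward critical =
    map k2Structure⇒≅K2 bStructure⇒≅B (critical⇒structure connected (bipartition colour proper) critical)

  backward : (∃[ m ] (3 ≤ m × G ≅ K2 m)) ⊎ (∃[ p ] ∃[ q ] (3 ≤ p × 3 ≤ q × G ≅ B p q)) → Critical G 2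
  backward (inj₁ (m , 3≤m , G≅K2)) = k2Structure⇒critical (≅K2⇒k2Structure 3≤m G≅K2)
  backward (inj₂ (p , q , 3≤p , 3≤q , G≅B)) = bStructure⇒critical (≅B⇒bStructure 3≤p 3≤q G≅B)
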